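{- For every $k\ge 1$ there is a bijection $\Phi$ between semistandard oscillating tableaux of length $k$ and $k\times k$ natural-number fixed-point-free involutions, such that if $\Phi(\mu^0,\ldots,\mu^k)=A$ then for each $1\le i\le k$, $r_i(A)=\max(|\mu^i|-|\mu^{i-1}|,0)$ and $c_i(A)=\max(|\mu^{i-1}|-|\mu^i|,0)$; that is, the row content records the increases and the column content records the decreases of the oscillating tableau.
   Context: A vertical strip is a skew diagram with at most one box in each row. A semistandard oscillating tableau of length $k$ is a sequence of partitions $(\mu^0=\emptyset,\mu^1,\ldots,\mu^k=\emptyset)$ such that for all $i$, $\mu^i$ and $\mu^{i+1}$ differ by a vertical strip (one contains the other and their difference is a vertical strip). $|\mu|$ denotes the number of boxes. For a $k\times k$ symmetric matrix $A=(a_{ij})$ with entries in $\mathbb{Z}_{\ge0}$, let $r_i=\sum_{j\ge i}a_{ij}$ (the $i$-th row from the main diagonal to the right end) and $c_i=\sum_{j\le i}a_{ji}$ (the $i$-th column from the top down to the main diagonal). $A$ is a natural-number fixed-point-free involution if it is symmetric with natural-number entries and $r_i=0$ or $c_i=0$ for every $i$. -}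

module Defs where

open import Data.Nat using (ℕ; zero; suc; _≤_; _<_)
open import Data.List using (List; []; _∷_; map; filter)
open import Data.Nat.ListAction using (sum)
import Data.Vec.Relation.Unary.All as VAll
open import Data.List.Relation.Unary.All using (All)
open import Data.List.Relation.Unary.Linked using (Linked)
open import Data.Vec as V using (Vec)
open import Data.Fin as F using (Fin; toℕ; inject₁)
open import Data.Fin.Properties using () renaming (_≤?_ to _≤ᶠ?_)
open import Data.List using (allFin)
open import Data.Product using (Σ; _×_)
open import Data.Sum using (_⊎_)
open import Relation.Binary.PropositionalEquality using (_≡_)

Partition : Set
Partition = List ℕ

IsPartition : Partition → Set
IsPartition λ′ = All (0 <_) λ′ × Linked (λ a b → b ≤ a) λ′

-- i-th part (0-based), 0 beyond the length
part : Partition → ℕ → ℕ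
part []       _       = 0
part (a ∷ _)  zero    = a
part (_ ∷ as) (suc i) = part as i

size : Partition → ℕ
size = sum

VerticalStrip : Partition → Partition → Set
VerticalStrip μ ν = ∀ i → part μ i ≤ part ν i × part ν i ≤ suc (part μ i)

DifferByVStrip : Partition → Partition → Set
DifferByVStrip μ ν = VerticalStrip μ ν ⊎ VerticalStrip ν μ

IsOscTableau : (k : ℕ) → Vec Partition (suc k) → Set
IsOscTableau k v =
  VAll.All IsPartition v ×
  (V.head v ≡ []) ×
  (V.last v ≡ []) ×
  (∀ (i : Fin k) → DifferByVStrip (V.lookup v (inject₁ i)) (V.lookup v (F.suc i)))

OscTableau : ℕ → Set
OscTableau k = Σ (Vec Partition (suc k)) (IsOscTableau k)

Matrix : ℕ → Set
Matrix k = Vec (Vec ℕ k) k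

entry : ∀ {k} → Matrix k → Fin k → Fin k → ℕ
entry A i j = V.lookup (V.lookup A i) j

IsSymmetric : ∀ {k} → Matrix k → Set
IsSymmetric A = ∀ i j → entry A i j ≡ entry A j i

rowContent : ∀ {k} → Matrix k → Fin k → ℕ
rowContent {k} A i = sum (map (entry A i) (filter (i ≤ᶠ?_) (allFin k)))

colContent : ∀ {k} → Matrix k → Fin k → ℕ
colContent {k} A i = sum (map (λ j → entry A j i) (filter (_≤ᶠ? i) (allFin k)))

IsNNFPFI : ∀ {k} → Matrix k → Set
IsNNFPFI A = IsSymmetric A × (∀ i → rowContent A i ≡ 0 ⊎ colContent A i ≡ 0)

NNFPFI : ℕ → Set
NNFPFI k = Σ (Matrix k) IsNNFPFI

module Submission where

-- Φ is a growth-diagram construction.  Partitions are replaced by their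
-- conjugates ("shapes", the sequences of column lengths), so that adding a
-- vertical strip becomes interlacing l ⊂ᵛ v:  l c ≤ v c  and  v (c+1) ≤ l c.
-- On shapes the local rule is plain arithmetic: for s ⊂ᵛ v ⊃ᵛ r it produces
-- a corner `shrink s v r` below s and r and a number `excess s v r`; the rule
-- `grow` inverts it, and sizes satisfy |v| + |shrink| = excess + |s| + |r|.

open import Defs
open import Data.Nat
open import Data.Nat.Properties
open import Data.Nat.ListAction using (sum)
open import Data.Nat.Tactic.RingSolver using (solve-∀)
open import Data.Bool using (true; false)
open import Data.Empty using (⊥-elim)
open import Data.Product using (Σ; _×_; _,_; proj₁; proj₂; ∃)
open import Data.Sum using (_⊎_; inj₁; inj₂)
open import Data.Fin using (Fin; inject₁; toℕ)
import Data.Fin as F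
import Data.Fin.Properties as FP
open import Data.List using ([]; _∷_; map; filter; allFin; tabulate)
import Data.List.Properties as LP
open import Data.List.Membership.Propositional using (_∈_)
open import Data.List.Membership.Propositional.Properties using (∈-filter⁺; ∈-allFin)
open import Data.List.Relation.Unary.Any using (here; there)
import Data.List.Relation.Unary.All as LA
import Data.List.Relation.Unary.Linked as LL
open import Data.Vec using (lookup)
import Data.Vec as V
import Data.Vec.Properties as VP
import Data.Vec.Relation.Unary.All as VAll
import Data.Vec.Relation.Unary.All.Properties as VAllP
open import Function using (_∘_; id)
open import Relation.Unary using (Decidable)
open import Relation.Binary using (tri<; tri≈; tri>)
open import Relation.Nullary using (yes; no; ¬_; Dec; does)
open import Relation.Nullary.Decidable using (toSum)
open import Relation.Binary.PropositionalEquality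
  using (_≡_; _≢_; refl; sym; trans; cong; cong₂; cong-app; subst; subst₂; _≗_; module ≡-Reasoning)

sumBelow : (ℕ → ℕ) → ℕ → ℕ
sumBelow f zero    = 0
sumBelow f (suc n) = sumBelow f n + f n

sumBelow-cong : ∀ {f g} n → (∀ c → c < n → f c ≡ g c) → sumBelow f n ≡ sumBelow g n
sumBelow-cong zero    e = refl
sumBelow-cong (suc n) e =
  cong₂ _+_ (sumBelow-cong n (λ c c<n → e c (m<n⇒m<1+n c<n))) (e n ≤-refl)

sumBelow-+ : ∀ f g n → sumBelow (λ c → f c + g c) n ≡ sumBelow f n + sumBelow g n
sumBelow-+ f g zero    = refl
sumBelow-+ f g (suc n) rewrite sumBelow-+ f g n =
  exchange (sumBelow f n) (sumBelow g n) (f n) (g n)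
  where
  exchange : ∀ a b x y → a + b + (x + y) ≡ a + x + (b + y)
  exchange = solve-∀

sumBelow-shift : ∀ f n → sumBelow f (suc n) ≡ f 0 + sumBelow (f ∘ suc) n
sumBelow-shift f zero    = +-comm 0 (f 0)
sumBelow-shift f (suc n) = begin
  sumBelow f (suc n) + f (suc n)            ≡⟨ cong (_+ f (suc n)) (sumBelow-shift f n) ⟩
  f 0 + sumBelow (f ∘ suc) n + f (suc n)    ≡⟨ +-assoc (f 0) _ _ ⟩
  f 0 + (sumBelow (f ∘ suc) n + f (suc n))  ∎
  where open ≡-Reasoning

sumBelow-mono : ∀ {f g} n → (∀ c → f c ≤ g c) → sumBelow f n ≤ sumBelow g n
sumBelow-mono zero    le = z≤n
sumBelow-mono (suc n) le = +-mono-≤ (sumBelow-mono n le) (le n)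

sumBelow-monoʳ : ∀ f {n N} → n ≤ N → sumBelow f n ≤ sumBelow f N
sumBelow-monoʳ f {n} {zero}  z≤n  = ≤-refl
sumBelow-monoʳ f {n} {suc N} n≤1+N with m≤n⇒m<n∨m≡n n≤1+N
... | inj₂ refl       = ≤-refl
... | inj₁ (s≤s n≤N)  = ≤-trans (sumBelow-monoʳ f n≤N) (m≤m+n _ (f N))

sumBelow-stable : ∀ f {n} N → (∀ c → n ≤ c → f c ≡ 0) → n ≤ N → sumBelow f N ≡ sumBelow f n
sumBelow-stable f zero    z z≤n = refl
sumBelow-stable f (suc N) z n≤1+N with m≤n⇒m<n∨m≡n n≤1+N
... | inj₂ refl = refl
... | inj₁ (s≤s n≤N) rewrite sumBelow-stable f N z n≤N | z N n≤N = +-identityʳ _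

sumBelow-zero : ∀ f n → (∀ c → c < n → f c ≡ 0) → sumBelow f n ≡ 0
sumBelow-zero f zero    _ = refl
sumBelow-zero f (suc n) z
  rewrite sumBelow-zero f n (λ c c<n → z c (m<n⇒m<1+n c<n)) | z n ≤-refl = refl

sumBelow-zero⁻¹ : ∀ f n → sumBelow f n ≡ 0 → ∀ c → c < n → f c ≡ 0
sumBelow-zero⁻¹ f (suc n) e c c<1+n with m≤n⇒m<n∨m≡n (s≤s⁻¹ c<1+n)
... | inj₂ refl = m+n≡0⇒n≡0 (sumBelow f n) e
... | inj₁ c<n  = sumBelow-zero⁻¹ f n (m+n≡0⇒m≡0 (sumBelow f n) e) c c<n

sumBelow-ones : ∀ f n → (∀ c → c < n → f c ≡ 1) → sumBelow f n ≡ n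
sumBelow-ones f zero    _ = refl
sumBelow-ones f (suc n) o
  rewrite sumBelow-ones f n (λ c c<n → o c (m<n⇒m<1+n c<n)) | o n ≤-refl = +-comm n 1

sumBelow-indicator : ∀ f c N → (∀ c′ → f c′ ≤ 1) → (∀ c′ → c ≤ c′ → f c′ ≡ 0) →
  sumBelow f N ≤ c
sumBelow-indicator f c zero    _   _ = z≤n
sumBelow-indicator f c (suc N) le1 z with c ≤? N
... | yes c≤N rewrite z N c≤N =
  subst (_≤ c) (sym (+-identityʳ _)) (sumBelow-indicator f c N le1 z)
... | no c≰N = ≤-trans (sum≤length (suc N)) (≰⇒> c≰N)
  where
  sum≤length : ∀ n → sumBelow f n ≤ n
  sum≤length zero    = z≤n
  sum≤length (suc n) = subst (sumBelow f n + f n ≤_) (+-comm n 1) (+-mono-≤ (sum≤length n) (le1 n))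

+-≤-≡ : ∀ {a b x y} → a ≤ b → x ≤ y → a + x ≡ b + y → a ≡ b × x ≡ y
+-≤-≡ {a} a≤b x≤y e with m≤n⇒m<n∨m≡n a≤b
... | inj₂ refl = refl , +-cancelˡ-≡ a _ _ e
... | inj₁ a<b  = ⊥-elim (<-irrefl e (+-mono-<-≤ a<b x≤y))

sumBelow-≤-≡ : ∀ {f g} n → (∀ c → f c ≤ g c) → sumBelow f n ≡ sumBelow g n →
  ∀ c → c < n → f c ≡ g c
sumBelow-≤-≡ (suc n) le e c c<1+n
  with +-≤-≡ (sumBelow-mono n le) (le n) e | m≤n⇒m<n∨m≡n (s≤s⁻¹ c<1+n)
... | _   , eₙ | inj₂ refl = eₙ
... | e<n , _  | inj₁ c<n  = sumBelow-≤-≡ n le e<n c c<n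

≤-suc-cases : ∀ {s t} → s ≤ suc t → s ≤ t ⊎ s ≡ suc t
≤-suc-cases s≤1+t with m≤n⇒m<n∨m≡n s≤1+t
... | inj₁ (s≤s s≤t) = inj₁ s≤t
... | inj₂ s≡1+t     = inj₂ s≡1+t

<-suc-cases : ∀ {s t} → s < suc t → s < t ⊎ s ≡ t
<-suc-cases (s≤s s≤t) = m≤n⇒m<n∨m≡n s≤t

update : ∀ {A : Set} → ℕ → A → (ℕ → A) → (ℕ → A)
update n x f s with s ≟ n
... | yes _ = x
... | no  _ = f s

update-same : ∀ {A : Set} n (x : A) f → update n x f n ≡ x
update-same n x f with n ≟ n
... | yes _  = refl
... | no n≢n = ⊥-elim (n≢n refl)

update-other : ∀ {A : Set} n (x : A) f s → s ≢ n → update n x f s ≡ f s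
update-other n x f s s≢n with s ≟ n
... | yes s≡n = ⊥-elim (s≢n s≡n)
... | no  _   = refl

update-< : ∀ {A : Set} n (x : A) f s → s < n → update n x f s ≡ f s
update-< n x f s s<n = update-other n x f s (<⇒≢ s<n)

sumBelow-update : ∀ t x f → sumBelow (update t x f) (suc t) ≡ sumBelow f t + x
sumBelow-update t x f =
  cong₂ _+_ (sumBelow-cong t (λ s s<t → update-< t x f s s<t)) (update-same t x f)

-- A partition is represented by its conjugate, the sequence of its
-- column lengths.  For partitions μ ⊆ ν, ν / μ is a vertical strip exactly
-- when the conjugates interlace: μ′ c ≤ ν′ c and ν′ (c + 1) ≤ μ′ c.

Shape : Set
Shape = ℕ → ℕ

infix 4 _⊂ᵛ_
_⊂ᵛ_ : Shape → Shape → Set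
l ⊂ᵛ v = ∀ c → l c ≤ v c × v (suc c) ≤ l c

IsEmpty : Shape → Set
IsEmpty f = ∀ c → f c ≡ 0

VanishFrom : Shape → ℕ → Set
VanishFrom f n = ∀ c → n ≤ c → f c ≡ 0

Decreasing : Shape → Set
Decreasing f = ∀ c → f (suc c) ≤ f c

≗-sym : ∀ {f g : Shape} → f ≗ g → g ≗ f
≗-sym e c = sym (e c)

≗-trans : ∀ {f g h : Shape} → f ≗ g → g ≗ h → f ≗ h
≗-trans e e′ c = trans (e c) (e′ c)

⊂ᵛ-cong : ∀ {a a′ b b′} → a ≗ a′ → b ≗ b′ → a ⊂ᵛ b → a′ ⊂ᵛ b′
⊂ᵛ-cong ea eb h c =
  subst₂ _≤_ (ea c) (eb c) (proj₁ (h c)) , subst₂ _≤_ (eb (suc c)) (ea c) (proj₂ (h c))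

⊂ᵛ-decreasingˡ : ∀ {l v} → l ⊂ᵛ v → Decreasing l
⊂ᵛ-decreasingˡ h c = ≤-trans (proj₁ (h (suc c))) (proj₂ (h c))

⊂ᵛ-decreasingʳ : ∀ {l v} → l ⊂ᵛ v → Decreasing v
⊂ᵛ-decreasingʳ h c = ≤-trans (proj₂ (h c)) (proj₁ (h c))

⊂ᵛ-refl : ∀ {f} → Decreasing f → f ⊂ᵛ f
⊂ᵛ-refl d c = ≤-refl , d c

empty-decreasing : ∀ {f} → IsEmpty f → Decreasing f
empty-decreasing {f} z c = subst₂ _≤_ (sym (z (suc c))) (sym (z c)) ≤-refl

VanishFrom-mono : ∀ {f n m} → VanishFrom f n → n ≤ m → VanishFrom f m
VanishFrom-mono z n≤m c m≤c = z c (≤-trans n≤m m≤c)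

⊂ᵛ-vanish : ∀ {l v n} → l ⊂ᵛ v → VanishFrom v n → VanishFrom l n
⊂ᵛ-vanish h z c n≤c = n≤0⇒n≡0 (subst (_ ≤_) (z c n≤c) (proj₁ (h c)))

⊂ᵛ-vanish-suc : ∀ {l v n} → l ⊂ᵛ v → VanishFrom l n → VanishFrom v (suc n)
⊂ᵛ-vanish-suc h z (suc c) (s≤s n≤c) = n≤0⇒n≡0 (subst (_ ≤_) (z c n≤c) (proj₂ (h c)))

⊂ᵛ-empty : ∀ {l v} → l ⊂ᵛ v → IsEmpty v → IsEmpty l
⊂ᵛ-empty h z c = n≤0⇒n≡0 (subst (_ ≤_) (z c) (proj₁ (h c)))

-- When s ⊂ᵛ v and r ⊂ᵛ v, the corner `shrink s v r` satisfies
-- shrink ⊂ᵛ s and shrink ⊂ᵛ r, and `excess s v r` is the number recorded in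
-- the matrix.

maxSh minSh : Shape → Shape → Shape
maxSh s r c = s c ⊔ r c
minSh s r c = s c ⊓ r c

shrink : Shape → Shape → Shape → Shape
shrink s v r c = (maxSh s r (suc c) + minSh s r c) ∸ v (suc c)

excess : Shape → Shape → Shape → ℕ
excess s v r = v 0 ∸ maxSh s r 0

grow : Shape → Shape → Shape → ℕ → Shape
grow s k r j zero    = j + maxSh s r 0
grow s k r j (suc c) = (maxSh s r (suc c) + minSh s r c) ∸ k c

-- max + min = sum; this drives the size identity of the local rule.
⊔-+-⊓ : ∀ a b → a ⊔ b + a ⊓ b ≡ a + b
⊔-+-⊓ a b with ≤-total a b
... | inj₁ a≤b rewrite m≤n⇒m⊔n≡n a≤b | m≤n⇒m⊓n≡m a≤b = +-comm b a
... | inj₂ b≤a rewrite m≥n⇒m⊔n≡m b≤a | m≥n⇒m⊓n≡n b≤a = refl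

≤-+-∸ : ∀ {a b x} → x ≤ b → a ≤ a + b ∸ x
≤-+-∸ {a} {b} {x} x≤b rewrite +-∸-assoc a x≤b = m≤m+n a (b ∸ x)

+-∸-≤ : ∀ {a b x} → a ≤ x → a + b ∸ x ≤ b
+-∸-≤ {a} {b} {x} a≤x = ≤-trans (∸-monoʳ-≤ (a + b) a≤x) (≤-reflexive (m+n∸m≡n a b))

shrink-⊂ᵛ : ∀ s v r → s ⊂ᵛ v → r ⊂ᵛ v → shrink s v r ⊂ᵛ s × shrink s v r ⊂ᵛ r
shrink-⊂ᵛ s v r hs hr =
  (λ c → ≤-trans (below c) (m⊓n≤m (s c) (r c)) , ≤-trans (m≤m⊔n _ _) (above c)) ,
  (λ c → ≤-trans (below c) (m⊓n≤n (s c) (r c)) , ≤-trans (m≤n⊔m _ _) (above c))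
  where
  below : ∀ c → shrink s v r c ≤ minSh s r c
  below c = +-∸-≤ (⊔-lub (proj₁ (hs (suc c))) (proj₁ (hr (suc c))))
  above : ∀ c → maxSh s r (suc c) ≤ shrink s v r c
  above c = ≤-+-∸ (⊓-glb (proj₂ (hs c)) (proj₂ (hr c)))

grow-⊂ᵛ : ∀ s k r j → k ⊂ᵛ s → k ⊂ᵛ r → s ⊂ᵛ grow s k r j × r ⊂ᵛ grow s k r j
grow-⊂ᵛ s k r j hs hr =
  (λ c → ≤-trans (m≤m⊔n (s c) (r c)) (above c) , ≤-trans (below c) (m⊓n≤m (s c) (r c))) ,
  (λ c → ≤-trans (m≤n⊔m (s c) (r c)) (above c) , ≤-trans (below c) (m⊓n≤n (s c) (r c)))
  where
  below : ∀ c → grow s k r j (suc c) ≤ minSh s r c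
  below c = +-∸-≤ (⊔-lub (proj₂ (hs c)) (proj₂ (hr c)))
  above : ∀ c → maxSh s r c ≤ grow s k r j c
  above zero    = m≤n+m _ j
  above (suc c) = ≤-+-∸ (⊓-glb (proj₁ (hs c)) (proj₁ (hr c)))

shrink-grow : ∀ s k r j → k ⊂ᵛ s → k ⊂ᵛ r → shrink s (grow s k r j) r ≗ k
shrink-grow s k r j hs hr c =
  m∸[m∸n]≡n (≤-trans (⊓-glb (proj₁ (hs c)) (proj₁ (hr c))) (m≤n+m _ _))

excess-grow : ∀ s k r j → excess s (grow s k r j) r ≡ j
excess-grow s k r j = m+n∸n≡m j (maxSh s r 0)

grow-shrink : ∀ s v r → s ⊂ᵛ v → r ⊂ᵛ v → grow s (shrink s v r) r (excess s v r) ≗ v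
grow-shrink s v r hs hr zero    = m∸n+n≡m (⊔-lub (proj₁ (hs 0)) (proj₁ (hr 0)))
grow-shrink s v r hs hr (suc c) =
  m∸[m∸n]≡n (≤-trans (⊓-glb (proj₂ (hs c)) (proj₂ (hr c))) (m≤n+m _ _))

local-size : ∀ s v r n N → s ⊂ᵛ v → r ⊂ᵛ v → VanishFrom s n → VanishFrom r n → n < N →
  sumBelow v N + sumBelow (shrink s v r) N ≡ excess s v r + (sumBelow s N + sumBelow r N)
local-size s v r n (suc N) hs hr zs zr (s≤s n≤N) = begin
  sumBelow v (suc N) + (sumBelow κ N + κ N)
    ≡⟨ cong₂ (λ a b → a + (sumBelow κ N + b)) (sumBelow-shift v N) κ-last ⟩
  v 0 + sumBelow (v ∘ suc) N + (sumBelow κ N + 0)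
    ≡⟨ cong (v 0 + sumBelow (v ∘ suc) N +_) (+-identityʳ _) ⟩
  v 0 + sumBelow (v ∘ suc) N + sumBelow κ N
    ≡⟨ +-assoc (v 0) _ _ ⟩
  v 0 + (sumBelow (v ∘ suc) N + sumBelow κ N)
    ≡⟨ cong (v 0 +_) (sym (sumBelow-+ (v ∘ suc) κ N)) ⟩
  v 0 + sumBelow (λ c → v (suc c) + κ c) N
    ≡⟨ cong₂ _+_ (sym (m∸n+n≡m max₀≤v₀)) (sumBelow-cong N (λ c _ → column c)) ⟩
  excess s v r + maxSh s r 0 + sumBelow (λ c → maxSh s r (suc c) + minSh s r c) N
    ≡⟨ cong (excess s v r + maxSh s r 0 +_) (sumBelow-+ _ _ N) ⟩
  excess s v r + maxSh s r 0 + (sumBelow (maxSh s r ∘ suc) N + sumBelow (minSh s r) N)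
    ≡⟨ regroup (excess s v r) (maxSh s r 0) _ _ ⟩
  excess s v r + (maxSh s r 0 + sumBelow (maxSh s r ∘ suc) N + sumBelow (minSh s r) N)
    ≡⟨ cong₂ (λ a b → excess s v r + (a + b)) (sym (sumBelow-shift (maxSh s r) N)) min-last ⟩
  excess s v r + (sumBelow (maxSh s r) (suc N) + sumBelow (minSh s r) (suc N))
    ≡⟨ cong (excess s v r +_) (sym (sumBelow-+ (maxSh s r) (minSh s r) (suc N))) ⟩
  excess s v r + sumBelow (λ c → maxSh s r c + minSh s r c) (suc N)
    ≡⟨ cong (excess s v r +_) (sumBelow-cong (suc N) (λ c _ → ⊔-+-⊓ (s c) (r c))) ⟩
  excess s v r + sumBelow (λ c → s c + r c) (suc N)
    ≡⟨ cong (excess s v r +_) (sumBelow-+ s r (suc N)) ⟩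
  excess s v r + (sumBelow s (suc N) + sumBelow r (suc N)) ∎
  where
  open ≡-Reasoning
  κ = shrink s v r
  regroup : ∀ a b x y → a + b + (x + y) ≡ a + (b + x + y)
  regroup = solve-∀
  κ-last : κ N ≡ 0
  κ-last = n≤0⇒n≡0 (subst (κ N ≤_) (zs N n≤N) (proj₁ (proj₁ (shrink-⊂ᵛ s v r hs hr) N)))
  column : ∀ c → v (suc c) + κ c ≡ maxSh s r (suc c) + minSh s r c
  column c = trans (+-comm (v (suc c)) _)
                   (m∸n+n≡m (≤-trans (⊓-glb (proj₂ (hs c)) (proj₂ (hr c))) (m≤n+m _ _)))
  max₀≤v₀ : maxSh s r 0 ≤ v 0
  max₀≤v₀ = ⊔-lub (proj₁ (hs 0)) (proj₁ (hr 0))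
  min-last : sumBelow (minSh s r) N ≡ sumBelow (minSh s r) (suc N)
  min-last rewrite zs N n≤N = sym (+-identityʳ _)


maxSh-cong : ∀ {s s′ r r′} → s ≗ s′ → r ≗ r′ → maxSh s r ≗ maxSh s′ r′
maxSh-cong es er c = cong₂ _⊔_ (es c) (er c)

minSh-cong : ∀ {s s′ r r′} → s ≗ s′ → r ≗ r′ → minSh s r ≗ minSh s′ r′
minSh-cong es er c = cong₂ _⊓_ (es c) (er c)

shrink-cong : ∀ {s s′ v v′ r r′} → s ≗ s′ → v ≗ v′ → r ≗ r′ → shrink s v r ≗ shrink s′ v′ r′
shrink-cong es ev er c =
  cong₂ _∸_ (cong₂ _+_ (maxSh-cong es er (suc c)) (minSh-cong es er c)) (ev (suc c))

excess-cong : ∀ {s s′ v v′ r r′} → s ≗ s′ → v ≗ v′ → r ≗ r′ → excess s v r ≡ excess s′ v′ r′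
excess-cong es ev er = cong₂ _∸_ (ev 0) (maxSh-cong es er 0)

grow-cong : ∀ {s s′ k k′ r r′ j j′} → s ≗ s′ → k ≗ k′ → r ≗ r′ → j ≡ j′ →
  grow s k r j ≗ grow s′ k′ r′ j′
grow-cong es ek er refl zero    = cong (_ +_) (maxSh-cong es er 0)
grow-cong es ek er ej   (suc c) =
  cong₂ _∸_ (cong₂ _+_ (maxSh-cong es er (suc c)) (minSh-cong es er c)) (ek c)

Walk : Set
Walk = ℕ → Shape

UpWalk : ℕ → Walk → Set
UpWalk t τ = IsEmpty (τ 0) × (∀ s → s < t → τ s ⊂ᵛ τ (suc s))

UpWalk-pred : ∀ t τ → UpWalk (suc t) τ → UpWalk t τ
UpWalk-pred t τ (z , h) = z , λ s s<t → h s (m<n⇒m<1+n s<t)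

AgreeUpTo : ℕ → Walk → Walk → Set
AgreeUpTo t τ σ = ∀ s → s ≤ t → τ s ≗ σ s

AgreeBelow : ℕ → (ℕ → ℕ) → (ℕ → ℕ) → Set
AgreeBelow t a b = ∀ s → s < t → a s ≡ b s

agree-sym : ∀ {t τ σ} → AgreeUpTo t τ σ → AgreeUpTo t σ τ
agree-sym e s s≤t = ≗-sym (e s s≤t)

agree-trans : ∀ {t τ σ ρ} → AgreeUpTo t τ σ → AgreeUpTo t σ ρ → AgreeUpTo t τ ρ
agree-trans e e′ s s≤t = ≗-trans (e s s≤t) (e′ s s≤t)

agree-pred : ∀ {t τ σ} → AgreeUpTo (suc t) τ σ → AgreeUpTo t τ σ
agree-pred e s s≤t = e s (m≤n⇒m≤1+n s≤t)

below-trans : ∀ {t a b c} → AgreeBelow t a b → AgreeBelow t b c → AgreeBelow t a c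
below-trans e e′ s s<t = trans (e s s<t) (e′ s s<t)

below-pred : ∀ {t a b} → AgreeBelow (suc t) a b → AgreeBelow t a b
below-pred e s s<t = e s (m<n⇒m<1+n s<t)

update-below : ∀ t x τ → AgreeUpTo t (update (suc t) x τ) τ
update-below t x τ s s≤t = cong-app (update-< (suc t) x τ s (s≤s s≤t))

update-agree : ∀ t x τ σ → AgreeUpTo t τ σ → x ≗ σ (suc t) →
  AgreeUpTo (suc t) (update (suc t) x τ) σ
update-agree t x τ σ e ex s s≤1+t with ≤-suc-cases s≤1+t
... | inj₂ refl = ≗-trans (cong-app (update-same (suc t) x τ)) ex
... | inj₁ s≤t  = ≗-trans (update-below t x τ s s≤t) (e s s≤t)

update-cong : ∀ t x y τ σ → AgreeUpTo t τ σ → x ≗ y →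
  AgreeUpTo (suc t) (update (suc t) x τ) (update (suc t) y σ)
update-cong t x y τ σ e exy =
  update-agree t x τ _ (agree-trans e (agree-sym (update-below t y σ)))
                       (≗-trans exy (≗-sym (cong-app (update-same (suc t) y σ))))

updateCol-agree : ∀ t j a b → AgreeBelow t a b → j ≡ b t → AgreeBelow (suc t) (update t j a) b
updateCol-agree t j a b e ej s s<1+t with <-suc-cases s<1+t
... | inj₂ refl = trans (update-same t j a) ej
... | inj₁ s<t  = trans (update-< t j a s s<t) (e s s<t)

updateCol-cong : ∀ t j j′ a b → AgreeBelow t a b → j ≡ j′ →
  AgreeBelow (suc t) (update t j a) (update t j′ b)
updateCol-cong t j j′ a b e ej =
  updateCol-agree t j a _ (λ s s<t → trans (e s s<t) (sym (update-< t j′ b s s<t)))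
                          (trans ej (sym (update-same t j′ b)))

update-UpWalk : ∀ t x τ → UpWalk t τ → τ t ⊂ᵛ x → UpWalk (suc t) (update (suc t) x τ)
update-UpWalk t x τ (z , h) hx = start , step
  where
  start : IsEmpty (update (suc t) x τ 0)
  start c = trans (cong-app (update-< (suc t) x τ 0 z<s) c) (z c)
  step : ∀ s → s < suc t → update (suc t) x τ s ⊂ᵛ update (suc t) x τ (suc s)
  step s s<1+t with <-suc-cases s<1+t
  ... | inj₂ refl = subst₂ _⊂ᵛ_ (sym (update-< (suc t) x τ s ≤-refl))
                                (sym (update-same (suc t) x τ)) hx
  ... | inj₁ s<t  = subst₂ _⊂ᵛ_ (sym (update-< (suc t) x τ s (m<n⇒m<1+n s<t)))
                                (sym (update-< (suc t) x τ (suc s) (s≤s s<t))) (h s s<t)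

-- For an up-walk τ of length t and ρ ⊂ᵛ τ t, pushing ρ replaces
-- τ t by ρ and each earlier τ s by the corner of the square
-- (τ s, τ (s + 1), new shape at s + 1); the excesses of the squares form a
-- column of numbers indexed by s < t.

pushWalk : ℕ → Walk → Shape → Walk
pushWalk zero    τ ρ = λ _ → ρ
pushWalk (suc t) τ ρ = update (suc t) ρ (pushWalk t τ (shrink (τ t) (τ (suc t)) ρ))

pushCol : ℕ → Walk → Shape → (ℕ → ℕ)
pushCol zero    τ ρ = λ _ → 0
pushCol (suc t) τ ρ =
  update t (excess (τ t) (τ (suc t)) ρ) (pushCol t τ (shrink (τ t) (τ (suc t)) ρ))

pull : ℕ → Walk → (ℕ → ℕ) → Walk
pull zero    τ col = τ
pull (suc t) τ col =
  update (suc t) (grow (pull t τ col t) (τ t) (τ (suc t)) (col t)) (pull t τ col)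

push-top : ∀ t τ ρ → pushWalk t τ ρ t ≡ ρ
push-top zero    τ ρ = refl
push-top (suc t) τ ρ = update-same (suc t) ρ _

pushCol-beyond : ∀ t τ ρ s → t ≤ s → pushCol t τ ρ s ≡ 0
pushCol-beyond zero    τ ρ s _   = refl
pushCol-beyond (suc t) τ ρ s t<s =
  trans (update-other t _ _ s (λ s≡t → <-irrefl (sym s≡t) t<s)) (pushCol-beyond t τ _ s (<⇒≤ t<s))

push-cong : ∀ t τ τ′ ρ ρ′ → AgreeUpTo t τ τ′ → ρ ≗ ρ′ →
  AgreeUpTo t (pushWalk t τ ρ) (pushWalk t τ′ ρ′) × AgreeBelow t (pushCol t τ ρ) (pushCol t τ′ ρ′)
push-cong zero    τ τ′ ρ ρ′ eτ eρ = (λ _ _ → eρ) , (λ _ ())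
push-cong (suc t) τ τ′ ρ ρ′ eτ eρ =
  update-cong t ρ ρ′ _ _ (proj₁ ih) eρ ,
  updateCol-cong t _ _ _ _ (proj₂ ih) (excess-cong eσ eν eρ)
  where
  eσ = eτ t (n≤1+n t)
  eν = eτ (suc t) ≤-refl
  ih = push-cong t τ τ′ _ _ (agree-pred eτ) (shrink-cong eσ eν eρ)

pull-cong : ∀ t τ τ′ col col′ → AgreeUpTo t τ τ′ → AgreeBelow t col col′ →
  AgreeUpTo t (pull t τ col) (pull t τ′ col′)
pull-cong zero    τ τ′ col col′ eτ ec = eτ
pull-cong (suc t) τ τ′ col col′ eτ ec =
  update-cong t _ _ _ _ ih
    (grow-cong (ih t ≤-refl) (eτ t (n≤1+n t)) (eτ (suc t) ≤-refl) (ec t ≤-refl))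
  where
  ih = pull-cong t τ τ′ col col′ (agree-pred eτ) (below-pred ec)

push-UpWalk : ∀ t τ ρ → UpWalk t τ → ρ ⊂ᵛ τ t → UpWalk t (pushWalk t τ ρ)
push-UpWalk zero    τ ρ (z , _) h = ⊂ᵛ-empty h z , λ _ ()
push-UpWalk (suc t) τ ρ u@(_ , hs) h =
  update-UpWalk t ρ _ (push-UpWalk t τ κ (UpWalk-pred t τ u) (proj₁ corner))
                      (subst (_⊂ᵛ ρ) (sym (push-top t τ κ)) (proj₂ corner))
  where
  κ = shrink (τ t) (τ (suc t)) ρ
  corner = shrink-⊂ᵛ (τ t) (τ (suc t)) ρ (hs t ≤-refl) h

pull-UpWalk : ∀ t τ col → UpWalk t τ → UpWalk t (pull t τ col) × τ t ⊂ᵛ pull t τ col t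
pull-UpWalk zero    τ col u = u , ⊂ᵛ-refl (empty-decreasing (proj₁ u))
pull-UpWalk (suc t) τ col u@(_ , hs) =
  update-UpWalk t _ P (proj₁ ih) (proj₁ grown) ,
  subst (τ (suc t) ⊂ᵛ_) (sym (update-same (suc t) _ P)) (proj₂ grown)
  where
  ih = pull-UpWalk t τ col (UpWalk-pred t τ u)
  P = pull t τ col
  grown = grow-⊂ᵛ (P t) (τ t) (τ (suc t)) (col t) (proj₂ ih) (hs t ≤-refl)

pull-push : ∀ t τ ρ → UpWalk t τ → ρ ⊂ᵛ τ t →
  AgreeUpTo t (pull t (pushWalk t τ ρ) (pushCol t τ ρ)) τ
pull-push zero    τ ρ (z , _) h s z≤n c = trans (⊂ᵛ-empty h z c) (sym (z c))
pull-push (suc t) τ ρ u@(_ , hs) h =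
  update-agree t _ P τ P≈τ
    (≗-trans (grow-cong (P≈τ t ≤-refl) W-t W-top (update-same t j _))
             (grow-shrink σ ν ρ (hs t ≤-refl) h))
  where
  σ = τ t
  ν = τ (suc t)
  κ = shrink σ ν ρ
  j = excess σ ν ρ
  W = pushWalk (suc t) τ ρ
  P = pull t W (pushCol (suc t) τ ρ)
  W-t : W t ≗ κ
  W-t = ≗-trans (update-below t ρ _ t ≤-refl) (cong-app (push-top t τ κ))
  W-top : W (suc t) ≗ ρ
  W-top = cong-app (update-same (suc t) ρ _)
  P≈τ : AgreeUpTo t P τ
  P≈τ = agree-trans
    (pull-cong t W _ _ (pushCol t τ κ) (update-below t ρ _) (λ s s<t → update-< t j _ s s<t))
    (pull-push t τ κ (UpWalk-pred t τ u) (proj₁ (shrink-⊂ᵛ σ ν ρ (hs t ≤-refl) h)))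

push-pull : ∀ t τ col → UpWalk t τ →
  AgreeUpTo t (pushWalk t (pull t τ col) (τ t)) τ × AgreeBelow t (pushCol t (pull t τ col) (τ t)) col
push-pull zero    τ col u = (λ { _ z≤n _ → refl }) , (λ _ ())
push-pull (suc t) τ col u@(_ , hs) =
  update-agree t _ _ τ (agree-trans (proj₁ pushed) (proj₁ ih)) (λ _ → refl) ,
  updateCol-agree t _ _ col (below-trans (proj₂ pushed) (proj₂ ih)) excess≡
  where
  P = pull t τ col
  Q = pull (suc t) τ col
  grown = proj₂ (pull-UpWalk t τ col (UpWalk-pred t τ u))
  Q-t : Q t ≗ P t
  Q-t = update-below t _ P t ≤-refl
  Q-top : Q (suc t) ≗ grow (P t) (τ t) (τ (suc t)) (col t)
  Q-top = cong-app (update-same (suc t) _ P)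
  corner : shrink (Q t) (Q (suc t)) (τ (suc t)) ≗ τ t
  corner = ≗-trans (shrink-cong {r = τ (suc t)} Q-t Q-top (λ _ → refl))
                   (shrink-grow (P t) (τ t) (τ (suc t)) (col t) grown (hs t ≤-refl))
  excess≡ : excess (Q t) (Q (suc t)) (τ (suc t)) ≡ col t
  excess≡ = trans (excess-cong {r = τ (suc t)} Q-t Q-top (λ _ → refl)) (excess-grow (P t) (τ t) (τ (suc t)) (col t))
  pushed = push-cong t Q P _ (τ t) (update-below t _ P) corner
  ih = push-pull t τ col (UpWalk-pred t τ u)

UpWalk-vanish : ∀ t τ → UpWalk t τ → ∀ s → s ≤ t → VanishFrom (τ s) s
UpWalk-vanish t τ (z , _)    zero    _     c _ = z c
UpWalk-vanish t τ u@(_ , hs) (suc s) s<t =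
  ⊂ᵛ-vanish-suc (hs s s<t) (UpWalk-vanish t τ u s (<⇒≤ s<t))

module Sizes (N : ℕ) where

  sizeSh : Shape → ℕ
  sizeSh f = sumBelow f N

  sizeSh-cong : ∀ {f g} → f ≗ g → sizeSh f ≡ sizeSh g
  sizeSh-cong e = sumBelow-cong N (λ c _ → e c)

  ⊂ᵛ-size : ∀ {l v} → l ⊂ᵛ v → sizeSh l ≤ sizeSh v
  ⊂ᵛ-size h = sumBelow-mono N (λ c → proj₁ (h c))

  ⊂ᵛ-size-≡ : ∀ {l v} → l ⊂ᵛ v → VanishFrom v N → sizeSh l ≡ sizeSh v → l ≗ v
  ⊂ᵛ-size-≡ {l} {v} h z e c with c <? N
  ... | yes c<N = sumBelow-≤-≡ N (λ c → proj₁ (h c)) e c c<N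
  ... | no  c≮N = trans (⊂ᵛ-vanish h z c (≮⇒≥ c≮N)) (sym (z c (≮⇒≥ c≮N)))

  rise : Walk → ℕ → ℕ
  rise τ s = sizeSh (τ (suc s)) ∸ sizeSh (τ s)

  push-square : ∀ t τ ρ → UpWalk (suc t) τ → ρ ⊂ᵛ τ (suc t) → suc t < N →
    sizeSh (τ (suc t)) + sizeSh (shrink (τ t) (τ (suc t)) ρ)
      ≡ excess (τ t) (τ (suc t)) ρ + (sizeSh (τ t) + sizeSh ρ)
  push-square t τ ρ u h 1+t<N =
    local-size (τ t) (τ (suc t)) ρ (suc t) N (proj₂ u t ≤-refl) h
      (VanishFrom-mono (UpWalk-vanish (suc t) τ u t (n≤1+n t)) (n≤1+n t))
      (⊂ᵛ-vanish h (UpWalk-vanish (suc t) τ u (suc t) ≤-refl)) 1+t<N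

  pushCol-sum : ∀ t τ ρ → UpWalk t τ → ρ ⊂ᵛ τ t → t < N →
    sumBelow (pushCol t τ ρ) t + sizeSh ρ ≡ sizeSh (τ t)
  pushCol-sum zero    τ ρ (z , _) h _ =
    sumBelow-cong N (λ c _ → trans (⊂ᵛ-empty h z c) (sym (z c)))
  pushCol-sum (suc t) τ ρ u@(_ , hs) h 1+t<N = begin
    sumBelow col t + col t + sizeSh ρ
      ≡⟨ cong (_+ sizeSh ρ) (sumBelow-update t j (pushCol t τ κ)) ⟩
    sumBelow (pushCol t τ κ) t + j + sizeSh ρ
      ≡⟨ balance ih (push-square t τ ρ u h 1+t<N) ⟩
    sizeSh ν ∎
    where
    open ≡-Reasoning
    σ = τ t
    ν = τ (suc t)
    κ = shrink σ ν ρ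
    j = excess σ ν ρ
    col = pushCol (suc t) τ ρ
    ih = pushCol-sum t τ κ (UpWalk-pred t τ u) (proj₁ (shrink-⊂ᵛ σ ν ρ (hs t ≤-refl) h))
           (<-trans (n<1+n t) 1+t<N)
    balance : ∀ {A j r k s v} → A + k ≡ s → v + k ≡ j + (s + r) → A + j + r ≡ v
    balance {A} {j} {r} {k} {s} {v} refl e =
      +-cancelʳ-≡ k _ _ (trans (shuffle A j r k) (sym e))
      where
      shuffle : ∀ A j r k → A + j + r + k ≡ j + (A + k + r)
      shuffle = solve-∀

  push-rise-last : ∀ t τ ρ → UpWalk (suc t) τ → ρ ⊂ᵛ τ (suc t) → suc t < N →
    rise (pushWalk (suc t) τ ρ) t + pushCol (suc t) τ ρ t ≡ rise τ t
  push-rise-last t τ ρ u@(_ , hs) h 1+t<N = begin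
    sizeSh (W (suc t)) ∸ sizeSh (W t) + pushCol (suc t) τ ρ t
      ≡⟨ cong₂ (λ a b → sizeSh a ∸ sizeSh b + pushCol (suc t) τ ρ t)
               (update-same (suc t) ρ _) (trans (update-< (suc t) ρ _ t ≤-refl) (push-top t τ κ)) ⟩
    sizeSh ρ ∸ sizeSh κ + pushCol (suc t) τ ρ t
      ≡⟨ cong (sizeSh ρ ∸ sizeSh κ +_) (update-same t j _) ⟩
    sizeSh ρ ∸ sizeSh κ + j
      ≡⟨ difference (push-square t τ ρ u h 1+t<N)
                    (⊂ᵛ-size (proj₂ (shrink-⊂ᵛ σ ν ρ (hs t ≤-refl) h))) (⊂ᵛ-size (hs t ≤-refl)) ⟩
    sizeSh ν ∸ sizeSh σ ∎
    where
    open ≡-Reasoning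
    σ = τ t
    ν = τ (suc t)
    κ = shrink σ ν ρ
    j = excess σ ν ρ
    W = pushWalk (suc t) τ ρ
    difference : ∀ {a b c d j} → a + d ≡ j + (b + c) → d ≤ c → b ≤ a → c ∸ d + j ≡ a ∸ b
    difference {a} {b} {c} {d} {j} e d≤c b≤a = +-cancelʳ-≡ (b + d) _ _ (begin
      c ∸ d + j + (b + d)   ≡⟨ shuffle (c ∸ d) j b d ⟩
      j + (b + (c ∸ d + d)) ≡⟨ cong (λ x → j + (b + x)) (m∸n+n≡m d≤c) ⟩
      j + (b + c)           ≡⟨ sym e ⟩
      a + d                 ≡⟨ cong (_+ d) (sym (m∸n+n≡m b≤a)) ⟩
      a ∸ b + b + d         ≡⟨ +-assoc (a ∸ b) b d ⟩
      a ∸ b + (b + d)       ∎)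
      where
      shuffle : ∀ x j b d → x + j + (b + d) ≡ j + (b + (x + d))
      shuffle = solve-∀

  push-rise : ∀ t τ ρ → UpWalk t τ → ρ ⊂ᵛ τ t → t < N →
    ∀ s → s < t → rise (pushWalk t τ ρ) s + pushCol t τ ρ s ≡ rise τ s
  push-rise (suc t) τ ρ u h 1+t<N s s<1+t with <-suc-cases s<1+t
  ... | inj₂ refl = push-rise-last t τ ρ u h 1+t<N
  ... | inj₁ s<t  = begin
    sizeSh (W (suc s)) ∸ sizeSh (W s) + pushCol (suc t) τ ρ s
      ≡⟨ cong₂ (λ a b → sizeSh a ∸ sizeSh b + b′)
               (update-< (suc t) ρ _ (suc s) (s≤s s<t)) (update-< (suc t) ρ _ s (m<n⇒m<1+n s<t)) ⟩
    rise (pushWalk t τ κ) s + b′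
      ≡⟨ cong (rise (pushWalk t τ κ) s +_) (update-< t _ _ s s<t) ⟩
    rise (pushWalk t τ κ) s + pushCol t τ κ s
      ≡⟨ push-rise t τ κ (UpWalk-pred t τ u)
           (proj₁ (shrink-⊂ᵛ (τ t) (τ (suc t)) ρ (proj₂ u t ≤-refl) h)) (<-trans (n<1+n t) 1+t<N) s s<t ⟩
    rise τ s ∎
    where
    open ≡-Reasoning
    κ = shrink (τ t) (τ (suc t)) ρ
    W = pushWalk (suc t) τ ρ
    b′ = pushCol (suc t) τ ρ s

UpWalk-empty : ∀ t τ → UpWalk t τ → IsEmpty (τ t) → ∀ s → s ≤ t → IsEmpty (τ s)
UpWalk-empty zero    τ u z _ z≤n = z
UpWalk-empty (suc t) τ u z s s≤1+t with ≤-suc-cases s≤1+t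
... | inj₂ refl = z
... | inj₁ s≤t  = UpWalk-empty t τ (UpWalk-pred t τ u) (⊂ᵛ-empty (proj₂ u t ≤-refl) z) s s≤t

UpWalk-decreasing : ∀ t τ → UpWalk t τ → ∀ s → s ≤ t → Decreasing (τ s)
UpWalk-decreasing t τ (z , _) zero    _   = empty-decreasing z
UpWalk-decreasing t τ (_ , h) (suc s) s<t = ⊂ᵛ-decreasingʳ (h s s<t)

-- Tables: the strictly upper triangular part of a symmetric matrix, as a
-- function of (row, column); column t is written at step t of the scan.

Table : Set
Table = ℕ → ℕ → ℕ

LowerZero : Table → Set
LowerZero a = ∀ s u → u ≤ s → a s u ≡ 0

setColumn : ℕ → (ℕ → ℕ) → Table → Table
setColumn t col a s = update t (col s) (a s)

setColumn-LowerZero : ∀ t col a → LowerZero a → (∀ s → t ≤ s → col s ≡ 0) →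
  LowerZero (setColumn t col a)
setColumn-LowerZero t col a low z s u u≤s with u ≟ t
... | yes refl = z s u≤s
... | no  _    = low s u u≤s

OscWalk : ℕ → Walk → Set
OscWalk t g = IsEmpty (g 0) × (∀ s → s < t → g s ⊂ᵛ g (suc s) ⊎ g (suc s) ⊂ᵛ g s)

OscWalk-≤ : ∀ {t t′} g → OscWalk t g → t′ ≤ t → OscWalk t′ g
OscWalk-≤ g (z , h) t′≤t = z , λ s s<t′ → h s (<-≤-trans s<t′ t′≤t)

-- Scanning an oscillating walk g of length ≤ k, the state
-- after t steps is an up-walk ending in g t together with the columns < t of
-- the table.  A decrease pushes g (t + 1) into the up-walk and stores the
-- pushed column; an increase just appends g (t + 1).
module Forward (k : ℕ) where

  open Sizes (suc k) public

  record State : Set where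
    constructor state
    field
      walk  : Walk
      table : Table
  open State public

  pushStep : ℕ → Shape → State → State
  pushStep t ρ st = state (update (suc t) ρ (pushWalk t (walk st) ρ))
                          (setColumn t (pushCol t (walk st) ρ) (table st))

  appendStep : ℕ → Shape → State → State
  appendStep t ρ st = state (update (suc t) ρ (walk st)) (setColumn t (λ _ → 0) (table st))

  step : ∀ {P : Set} → ℕ → Shape → State → Dec P → State
  step t ρ st (yes _) = pushStep t ρ st
  step t ρ st (no  _) = appendStep t ρ st

  forward : ℕ → Walk → State
  forward zero    g = state (λ _ → g 0) (λ _ _ → 0)
  forward (suc t) g = step t (g (suc t)) (forward t g) (sizeSh (g (suc t)) <? sizeSh (g t))

  step-table-other : ∀ {P : Set} t ρ st (d : Dec P) s u → u ≢ t →
    table (step t ρ st d) s u ≡ table st s u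
  step-table-other t ρ st (yes _) s u u≢t = update-other t _ _ u u≢t
  step-table-other t ρ st (no  _) s u u≢t = update-other t _ _ u u≢t

  forward-LowerZero : ∀ t g → LowerZero (table (forward t g))
  forward-LowerZero zero    g s u _ = refl
  forward-LowerZero (suc t) g with sizeSh (g (suc t)) <? sizeSh (g t)
  ... | yes _ = setColumn-LowerZero t _ _ (forward-LowerZero t g) (λ s → pushCol-beyond t _ _ s)
  ... | no  _ = setColumn-LowerZero t _ _ (forward-LowerZero t g) (λ _ _ → refl)

  forward-stable : ∀ t g s u → u < t → table (forward t g) s u ≡ table (forward (suc u) g) s u
  forward-stable (suc t) g s u u<1+t with <-suc-cases u<1+t
  ... | inj₂ refl = refl
  ... | inj₁ u<t  = trans (step-table-other t _ _ (sizeSh (g (suc t)) <? sizeSh (g t)) s u (<⇒≢ u<t))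
                          (forward-stable t g s u u<t)

  record ForwardInv (t : ℕ) (g : Walk) (st : State) : Set where
    field
      upWalk : UpWalk t (walk st)
      top    : walk st t ≡ g t
      row    : ∀ s → s < t →
        rise (walk st) s + sumBelow (table st s) t ≡ sizeSh (g (suc s)) ∸ sizeSh (g s)
      col    : ∀ u → u < t →
        sumBelow (λ s → table st s u) u ≡ sizeSh (g u) ∸ sizeSh (g (suc u))

  row-empty : ∀ t g → sumBelow (table (forward t g) t) t ≡ 0
  row-empty t g = sumBelow-zero _ t (λ u u<t → forward-LowerZero t g t u (<⇒≤ u<t))

  inv-push : ∀ t g → t < k → ForwardInv t g (forward t g) →
    sizeSh (g (suc t)) < sizeSh (g t) → g (suc t) ⊂ᵛ g t →
    ForwardInv (suc t) g (pushStep t (g (suc t)) (forward t g))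
  inv-push t g t<k I dec down =
    record { upWalk = upWalk′ ; top = update-same (suc t) ρ P ; row = row′ ; col = col′ }
    where
    open ForwardInv I
    τ = walk (forward t g)
    a = table (forward t g)
    ρ = g (suc t)
    ρ⊂τ : ρ ⊂ᵛ τ t
    ρ⊂τ = subst (ρ ⊂ᵛ_) (sym top) down
    P = pushWalk t τ ρ
    cl = pushCol t τ ρ
    t<N : t < suc k
    t<N = m<n⇒m<1+n t<k
    upWalk′ : UpWalk (suc t) (update (suc t) ρ P)
    upWalk′ = update-UpWalk t ρ P (push-UpWalk t τ ρ upWalk ρ⊂τ)
                (subst (_⊂ᵛ ρ) (sym (push-top t τ ρ)) (⊂ᵛ-refl (⊂ᵛ-decreasingˡ down)))
    row′ : ∀ s → s < suc t →
      rise (update (suc t) ρ P) s + sumBelow (setColumn t cl a s) (suc t) ≡ sizeSh (g (suc s)) ∸ sizeSh (g s)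
    row′ s s<1+t with <-suc-cases s<1+t
    ... | inj₂ refl = begin
      rise (update (suc t) ρ P) t + sumBelow (setColumn t cl a t) (suc t)
        ≡⟨ cong₂ (λ x y → sizeSh x ∸ sizeSh y + sumBelow (setColumn t cl a t) (suc t))
                 (update-same (suc t) ρ P) (trans (update-< (suc t) ρ P t ≤-refl) (push-top t τ ρ)) ⟩
      sizeSh ρ ∸ sizeSh ρ + sumBelow (setColumn t cl a t) (suc t)
        ≡⟨ cong₂ _+_ (n∸n≡0 (sizeSh ρ)) (sumBelow-update t (cl t) (a t)) ⟩
      sumBelow (a t) t + cl t
        ≡⟨ cong₂ _+_ (row-empty t g) (pushCol-beyond t τ ρ t ≤-refl) ⟩
      0
        ≡⟨ sym (m≤n⇒m∸n≡0 (<⇒≤ dec)) ⟩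
      sizeSh ρ ∸ sizeSh (g t) ∎
      where open ≡-Reasoning
    ... | inj₁ s<t = begin
      rise (update (suc t) ρ P) s + sumBelow (setColumn t cl a s) (suc t)
        ≡⟨ cong₂ (λ x y → sizeSh x ∸ sizeSh y + sumBelow (setColumn t cl a s) (suc t))
                 (update-< (suc t) ρ P (suc s) (s≤s s<t)) (update-< (suc t) ρ P s (m<n⇒m<1+n s<t)) ⟩
      rise P s + sumBelow (setColumn t cl a s) (suc t)
        ≡⟨ cong (rise P s +_) (sumBelow-update t (cl s) (a s)) ⟩
      rise P s + (sumBelow (a s) t + cl s)
        ≡⟨ regroup (rise P s) (sumBelow (a s) t) (cl s) ⟩
      rise P s + cl s + sumBelow (a s) t
        ≡⟨ cong (_+ sumBelow (a s) t) (push-rise t τ ρ upWalk ρ⊂τ t<N s s<t) ⟩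
      rise τ s + sumBelow (a s) t
        ≡⟨ row s s<t ⟩
      sizeSh (g (suc s)) ∸ sizeSh (g s) ∎
      where
      open ≡-Reasoning
      regroup : ∀ x y z → x + (y + z) ≡ x + z + y
      regroup = solve-∀
    col′ : ∀ u → u < suc t → sumBelow (λ s → setColumn t cl a s u) u ≡ sizeSh (g u) ∸ sizeSh (g (suc u))
    col′ u u<1+t with <-suc-cases u<1+t
    ... | inj₂ refl =
      trans (sumBelow-cong u (λ s _ → update-same u (cl s) (a s)))
            (trans (sym (m+n∸n≡m _ (sizeSh ρ)))
                   (cong (_∸ sizeSh ρ) (trans (pushCol-sum u τ ρ upWalk ρ⊂τ t<N) (cong sizeSh top))))
    ... | inj₁ u<t =
      trans (sumBelow-cong u (λ s _ → update-other t (cl s) (a s) u (<⇒≢ u<t))) (col u u<t)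

  inv-append : ∀ t g → ForwardInv t g (forward t g) →
    g t ⊂ᵛ g (suc t) → sizeSh (g t) ≤ sizeSh (g (suc t)) →
    ForwardInv (suc t) g (appendStep t (g (suc t)) (forward t g))
  inv-append t g I up inc =
    record { upWalk = upWalk′ ; top = update-same (suc t) ρ τ ; row = row′ ; col = col′ }
    where
    open ForwardInv I
    τ = walk (forward t g)
    a = table (forward t g)
    ρ = g (suc t)
    z0 = setColumn t (λ _ → 0) a
    upWalk′ : UpWalk (suc t) (update (suc t) ρ τ)
    upWalk′ = update-UpWalk t ρ τ upWalk (subst (_⊂ᵛ ρ) (sym top) up)
    row′ : ∀ s → s < suc t →
      rise (update (suc t) ρ τ) s + sumBelow (z0 s) (suc t) ≡ sizeSh (g (suc s)) ∸ sizeSh (g s)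
    row′ s s<1+t with <-suc-cases s<1+t
    ... | inj₂ refl = begin
      rise (update (suc t) ρ τ) t + sumBelow (z0 t) (suc t)
        ≡⟨ cong₂ (λ x y → sizeSh x ∸ sizeSh y + sumBelow (z0 t) (suc t))
                 (update-same (suc t) ρ τ) (trans (update-< (suc t) ρ τ t ≤-refl) top) ⟩
      sizeSh ρ ∸ sizeSh (g t) + sumBelow (z0 t) (suc t)
        ≡⟨ cong (sizeSh ρ ∸ sizeSh (g t) +_) (trans (sumBelow-update t 0 (a t)) (cong (_+ 0) (row-empty t g))) ⟩
      sizeSh ρ ∸ sizeSh (g t) + 0
        ≡⟨ +-identityʳ _ ⟩
      sizeSh ρ ∸ sizeSh (g t) ∎
      where open ≡-Reasoning
    ... | inj₁ s<t = begin
      rise (update (suc t) ρ τ) s + sumBelow (z0 s) (suc t)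
        ≡⟨ cong₂ (λ x y → sizeSh x ∸ sizeSh y + sumBelow (z0 s) (suc t))
                 (update-< (suc t) ρ τ (suc s) (s≤s s<t)) (update-< (suc t) ρ τ s (m<n⇒m<1+n s<t)) ⟩
      rise τ s + sumBelow (z0 s) (suc t)
        ≡⟨ cong (rise τ s +_) (trans (sumBelow-update t 0 (a s)) (+-identityʳ _)) ⟩
      rise τ s + sumBelow (a s) t
        ≡⟨ row s s<t ⟩
      sizeSh (g (suc s)) ∸ sizeSh (g s) ∎
      where open ≡-Reasoning
    col′ : ∀ u → u < suc t → sumBelow (λ s → z0 s u) u ≡ sizeSh (g u) ∸ sizeSh (g (suc u))
    col′ u u<1+t with <-suc-cases u<1+t
    ... | inj₂ refl = trans (sumBelow-zero _ u (λ s _ → update-same u 0 (a s))) (sym (m≤n⇒m∸n≡0 inc))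
    ... | inj₁ u<t  = trans (sumBelow-cong u (λ s _ → update-other t 0 (a s) u (<⇒≢ u<t))) (col u u<t)

  -- A step that does not decrease the size adds a vertical strip (a strip
  -- removed without losing boxes is empty).
  non-decrease-⊂ᵛ : ∀ {σ ρ} → σ ⊂ᵛ ρ ⊎ ρ ⊂ᵛ σ → VanishFrom σ (suc k) → ¬ sizeSh ρ < sizeSh σ → σ ⊂ᵛ ρ
  non-decrease-⊂ᵛ (inj₁ up)   _ _    = up
  non-decrease-⊂ᵛ (inj₂ down) z ¬dec =
    ⊂ᵛ-cong (λ _ → refl) (≗-sym (⊂ᵛ-size-≡ down z (≤-antisym (⊂ᵛ-size down) (≮⇒≥ ¬dec))))
            (⊂ᵛ-refl (⊂ᵛ-decreasingʳ down))

  forward-inv : ∀ t g → OscWalk t g → t ≤ k → ForwardInv t g (forward t g)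
  forward-inv zero g (z , _) _ =
    record { upWalk = z , (λ _ ()) ; top = refl ; row = λ _ () ; col = λ _ () }
  forward-inv (suc t) g gw 1+t≤k
    with forward-inv t g (OscWalk-≤ g gw (n≤1+n t)) (<⇒≤ 1+t≤k)
       | sizeSh (g (suc t)) <? sizeSh (g t) | proj₂ gw t ≤-refl
  ... | I | yes dec | inj₁ up   = ⊥-elim (<⇒≱ dec (⊂ᵛ-size up))
  ... | I | yes dec | inj₂ down = inv-push t g 1+t≤k I dec down
  ... | I | no ¬dec | strip     = inv-append t g I up (⊂ᵛ-size up)
    where
    up = non-decrease-⊂ᵛ strip
           (VanishFrom-mono (subst (λ x → VanishFrom x t) (ForwardInv.top I)
                               (UpWalk-vanish t _ (ForwardInv.upWalk I) t ≤-refl))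
                            (m≤n⇒m≤1+n (<⇒≤ 1+t≤k)))
           ¬dec

downward-induction : ∀ k (P : ℕ → Set) → P k → (∀ t → t < k → P (suc t) → P t) →
  ∀ t → t ≤ k → P t
downward-induction k P base step t t≤k = go (k ∸ t) t (m+[n∸m]≡n t≤k)
  where
  go : ∀ d t → t + d ≡ k → P t
  go zero    t e = subst P (trans (sym e) (+-identityʳ t)) base
  go (suc d) t e =
    step t (subst (t <_) e (m<m+n t z<s)) (go d (suc t) (trans (sym (+-suc t d)) e))

∸-suc : ∀ {t k} → t < k → k ∸ t ≡ suc (k ∸ suc t)
∸-suc t<k = +-∸-assoc 1 t<k

∸-∸-suc : ∀ {t k} → t < k → k ∸ suc (k ∸ suc t) ≡ t
∸-∸-suc (s≤s t≤k) = m∸[m∸n]≡n t≤k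

-- For a table a (the upper triangle of the matrix), the
-- walk is rebuilt from step k down to step 0: at step t the column t of a,
-- if it is nonzero, is pulled into the walk.
module Backward (k : ℕ) where

  open Forward k public

  colSum : Table → ℕ → ℕ
  colSum a t = sumBelow (λ s → a s t) t

  rowSum : Table → ℕ → ℕ
  rowSum a s = sumBelow (a s) k

  -- The conditions on a table that make its symmetrisation a natural-number
  -- fixed-point-free involution.
  record FPFTable (a : Table) : Set where
    field
      lowerZero      : LowerZero a
      fixedPointFree : ∀ t → t < k → colSum a t ≡ 0 ⊎ rowSum a t ≡ 0

  module Rebuild (a : Table) where

    column : ℕ → ℕ → ℕ
    column t s = a s t

    nextWalkD : ∀ {P : Set} → ℕ → Walk → Dec P → Walk
    nextWalkD t τ (yes _) = pull t τ (column t)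
    nextWalkD t τ (no  _) = τ

    nextWalk : ℕ → Walk → Walk
    nextWalk t τ = nextWalkD t τ (0 <? colSum a t)

    rebuild : ℕ → Walk
    rebuild zero    = λ _ _ → 0
    rebuild (suc d) = nextWalk (k ∸ suc d) (rebuild d)

    walkAt : ℕ → Walk
    walkAt t = rebuild (k ∸ t)

    walkAt-step : ∀ t → t < k → walkAt t ≡ nextWalk t (walkAt (suc t))
    walkAt-step t t<k rewrite ∸-suc t<k | ∸-∸-suc t<k = refl

    recovered : Walk
    recovered i = walkAt i i

    record BackwardInv (t : ℕ) (τ : Walk) : Set where
      field
        upWalk : UpWalk t τ
        rest   : ∀ s → s < t → rise τ s + sumBelow (a s) t ≡ rowSum a s

    module _ (fa : FPFTable a) where
      open FPFTable fa

      inv-step : ∀ t τ → t < k → BackwardInv (suc t) τ → BackwardInv t (nextWalk t τ)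
      inv-step t τ t<k I with 0 <? colSum a t
      ... | yes _ = record { upWalk = proj₁ (pull-UpWalk t τ (column t) upWalk′) ; rest = rest′ }
        where
        open BackwardInv I
        upWalk′ = UpWalk-pred t τ upWalk
        P = pull t τ (column t)
        pulled = pull-UpWalk t τ (column t) upWalk′
        pushed = push-pull t τ (column t) upWalk′
        rest′ : ∀ s → s < t → rise P s + sumBelow (a s) t ≡ rowSum a s
        rest′ s s<t = begin
          rise P s + sumBelow (a s) t
            ≡⟨ cong (_+ sumBelow (a s) t)
                 (sym (push-rise t P (τ t) (proj₁ pulled) (proj₂ pulled) (m<n⇒m<1+n t<k) s s<t)) ⟩
          rise (pushWalk t P (τ t)) s + pushCol t P (τ t) s + sumBelow (a s) t
            ≡⟨ cong₂ (λ x y → x + y + sumBelow (a s) t) same-rise (proj₂ pushed s s<t) ⟩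
          rise τ s + a s t + sumBelow (a s) t
            ≡⟨ regroup (rise τ s) (a s t) _ ⟩
          rise τ s + sumBelow (a s) (suc t)
            ≡⟨ rest s (m<n⇒m<1+n s<t) ⟩
          rowSum a s ∎
          where
          open ≡-Reasoning
          regroup : ∀ x y z → x + y + z ≡ x + (z + y)
          regroup = solve-∀
          same-rise : rise (pushWalk t P (τ t)) s ≡ rise τ s
          same-rise = cong₂ _∸_ (sizeSh-cong (proj₁ pushed (suc s) s<t))
                                (sizeSh-cong (proj₁ pushed s (<⇒≤ s<t)))
      ... | no ¬pos = record { upWalk = UpWalk-pred t τ upWalk ; rest = rest′ }
        where
        open BackwardInv I
        rest′ : ∀ s → s < t → rise τ s + sumBelow (a s) t ≡ rowSum a s
        rest′ s s<t = trans (cong (rise τ s +_) (sym (trans (cong (sumBelow (a s) t +_) zero-entry)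
                                                             (+-identityʳ _))))
                            (rest s (m<n⇒m<1+n s<t))
          where
          zero-entry : a s t ≡ 0
          zero-entry = sumBelow-zero⁻¹ (column t) t (n≤0⇒n≡0 (≮⇒≥ ¬pos)) s s<t

      walkAt-inv : ∀ t → t ≤ k → BackwardInv t (walkAt t)
      walkAt-inv = downward-induction k (λ t → BackwardInv t (walkAt t)) base
        (λ t t<k I → subst (BackwardInv t) (sym (walkAt-step t t<k)) (inv-step t _ t<k I))
        where
        empty-inv : BackwardInv k (λ _ _ → 0)
        empty-inv = record
          { upWalk = (λ _ → refl) , (λ _ _ _ → ≤-refl , ≤-refl)
          ; rest   = λ s _ → cong (_+ rowSum a s)
              (cong₂ _∸_ (sumBelow-zero _ (suc k) (λ _ _ → refl)) (sumBelow-zero _ (suc k) (λ _ _ → refl))) }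
        base : BackwardInv k (walkAt k)
        base rewrite n∸n≡0 k = empty-inv

      data StepKind (t : ℕ) : Set where
        pulled : 0 < colSum a t →
          recovered (suc t) ⊂ᵛ recovered t →
          colSum a t + sizeSh (recovered (suc t)) ≡ sizeSh (recovered t) →
          walkAt t ≡ pull t (walkAt (suc t)) (column t) →
          walkAt (suc t) t ≗ recovered (suc t) → StepKind t
        kept : colSum a t ≡ 0 → recovered t ⊂ᵛ recovered (suc t) →
          walkAt t ≡ walkAt (suc t) → StepKind t

      step-kind : ∀ t → t < k → StepKind t
      step-kind t t<k = classify (walkAt-step t t<k)
        where
        τ = walkAt (suc t)
        open BackwardInv (walkAt-inv (suc t) t<k)
        last⊂ = proj₂ upWalk t ≤-refl
        classify : walkAt t ≡ nextWalk t τ → StepKind t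
        classify eq with 0 <? colSum a t
        ... | no ¬pos = kept (n≤0⇒n≡0 (≮⇒≥ ¬pos))
                             (subst (_⊂ᵛ τ (suc t)) (sym (cong-app eq t)) last⊂) eq
        ... | yes pos = pulled pos (subst (τ (suc t) ⊂ᵛ_) (sym (cong-app eq t))
                                          (⊂ᵛ-cong last-equal (λ _ → refl) (proj₂ pulled′)))
                               sizes eq last-equal
          where
          upWalk′ = UpWalk-pred t τ upWalk
          P = pull t τ (column t)
          pulled′ = pull-UpWalk t τ (column t) upWalk′
          pushed = push-pull t τ (column t) upWalk′
          -- row t is entirely accounted for by column entries, so its last
          -- step is trivial
          no-rise : rise τ t ≡ 0
          no-rise with fixedPointFree t t<k
          ... | inj₁ c0 = ⊥-elim (<-irrefl (sym c0) pos)
          ... | inj₂ r0 = trans (sym (+-identityʳ _))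
              (trans (cong (rise τ t +_)
                       (sym (sumBelow-zero (a t) (suc t) (λ u u<1+t → lowerZero t u (m<1+n⇒m≤n u<1+t)))))
                     (trans (rest t ≤-refl) r0))
          last-equal : τ t ≗ τ (suc t)
          last-equal = ⊂ᵛ-size-≡ last⊂
            (VanishFrom-mono (UpWalk-vanish (suc t) τ upWalk (suc t) ≤-refl) (m≤n⇒m≤1+n t<k))
            (≤-antisym (⊂ᵛ-size last⊂) (m∸n≡0⇒m≤n no-rise))
          sizes : colSum a t + sizeSh (τ (suc t)) ≡ sizeSh (walkAt t t)
          sizes = begin
            colSum a t + sizeSh (τ (suc t))
              ≡⟨ cong₂ _+_ (sumBelow-cong t (λ s s<t → sym (proj₂ pushed s s<t)))
                           (sym (sizeSh-cong last-equal)) ⟩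
            sumBelow (pushCol t P (τ t)) t + sizeSh (τ t)
              ≡⟨ pushCol-sum t P (τ t) (proj₁ pulled′) (proj₂ pulled′) (m<n⇒m<1+n t<k) ⟩
            sizeSh (P t)
              ≡⟨ cong sizeSh (sym (cong-app eq t)) ⟩
            sizeSh (walkAt t t) ∎
            where open ≡-Reasoning

      Reproduces : ℕ → Set
      Reproduces t = AgreeUpTo t (walk (forward t recovered)) (walkAt t) ×
                     (∀ s u → u < t → table (forward t recovered) s u ≡ a s u)

      forward-recovered : ∀ t → t ≤ k → Reproduces t
      forward-recovered zero    _     = (λ { _ z≤n _ → refl }) , (λ _ _ ())
      forward-recovered (suc t) 1+t≤k = extend (step-kind t 1+t≤k) (forward-recovered t (<⇒≤ 1+t≤k))
        where
        τ̃ = walkAt (suc t)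
        ρ = recovered (suc t)
        τ = walk (forward t recovered)
        b = table (forward t recovered)
        extend : StepKind t → Reproduces t → Reproduces (suc t)
        extend (pulled pos _ sizes eq last-equal) (agree , entries)
          with sizeSh ρ <? sizeSh (recovered t)
        ... | no ¬dec = ⊥-elim (¬dec (subst (sizeSh ρ <_) sizes (m<n+m (sizeSh ρ) pos)))
        ... | yes _   =
          update-agree t ρ _ τ̃ (agree-trans (proj₁ pushed) (proj₁ restored)) (λ _ → refl) , entries′
          where
          P = pull t τ̃ (column t)
          agree′ : AgreeUpTo t τ P
          agree′ s s≤t c = trans (agree s s≤t c) (cong (λ w → w s c) eq)
          pushed = push-cong t τ P ρ (τ̃ t) agree′ (≗-sym last-equal)
          restored = push-pull t τ̃ (column t)
                       (UpWalk-pred t τ̃ (BackwardInv.upWalk (walkAt-inv (suc t) 1+t≤k)))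
          entries′ : ∀ s u → u < suc t → setColumn t (pushCol t τ ρ) b s u ≡ a s u
          entries′ s u u<1+t with <-suc-cases u<1+t
          ... | inj₁ u<t  = trans (update-other t _ _ u (<⇒≢ u<t)) (entries s u u<t)
          ... | inj₂ refl with s <? u
          ...   | yes s<u = trans (update-same u _ _) (trans (proj₂ pushed s s<u) (proj₂ restored s s<u))
          ...   | no  s≮u = trans (update-same u _ _)
                  (trans (pushCol-beyond u τ ρ s (≮⇒≥ s≮u)) (sym (lowerZero s u (≮⇒≥ s≮u))))
        extend (kept c0 up eq) (agree , entries) with sizeSh ρ <? sizeSh (recovered t)
        ... | yes dec = ⊥-elim (<⇒≱ dec (⊂ᵛ-size up))
        ... | no  _   = update-agree t ρ τ τ̃ agree′ (λ _ → refl) , entries′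
          where
          agree′ : AgreeUpTo t τ τ̃
          agree′ s s≤t c = trans (agree s s≤t c) (cong (λ w → w s c) eq)
          entries′ : ∀ s u → u < suc t → setColumn t (λ _ → 0) b s u ≡ a s u
          entries′ s u u<1+t with <-suc-cases u<1+t
          ... | inj₁ u<t  = trans (update-other t _ _ u (<⇒≢ u<t)) (entries s u u<t)
          ... | inj₂ refl with s <? u
          ...   | yes s<u = trans (update-same u _ _) (sym (sumBelow-zero⁻¹ (column u) u c0 s s<u))
          ...   | no  s≮u = trans (update-same u _ _) (sym (lowerZero s u (≮⇒≥ s≮u)))

  forward-cong : ∀ t g g′ → (∀ i → i ≤ t → g i ≗ g′ i) →
    AgreeUpTo t (walk (forward t g)) (walk (forward t g′)) ×
    (∀ s u → table (forward t g) s u ≡ table (forward t g′) s u)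
  forward-cong zero    g g′ e = (λ { _ z≤n → e 0 z≤n }) , (λ _ _ → refl)
  forward-cong (suc t) g g′ e
    with forward-cong t g g′ (λ i i≤t → e i (m≤n⇒m≤1+n i≤t))
       | sizeSh (g (suc t)) <? sizeSh (g t) | sizeSh (g′ (suc t)) <? sizeSh (g′ t)
  ... | _ | yes dec | no ¬dec = ⊥-elim (¬dec (subst₂ _<_ (sizeSh-cong e₁) (sizeSh-cong e₀) dec))
    where
    e₀ = e t (n≤1+n t)
    e₁ = e (suc t) ≤-refl
  ... | _ | no ¬dec | yes dec = ⊥-elim (¬dec (subst₂ _<_ (sym (sizeSh-cong e₁)) (sym (sizeSh-cong e₀)) dec))
    where
    e₀ = e t (n≤1+n t)
    e₁ = e (suc t) ≤-refl
  ... | (agree , entries) | no _ | no _ =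
    update-cong t _ _ _ _ agree (e (suc t) ≤-refl) ,
    (λ s → updateCol-cong′ (entries s))
    where
    updateCol-cong′ : ∀ {f f′ : ℕ → ℕ} → f ≗ f′ → update t 0 f ≗ update t 0 f′
    updateCol-cong′ ef u with u ≟ t
    ... | yes _ = refl
    ... | no  _ = ef u
  ... | (agree , entries) | yes _ | yes _ =
    update-cong t _ _ _ _ (proj₁ pushed) (e (suc t) ≤-refl) , entries′
    where
    pushed = push-cong t _ _ (g (suc t)) (g′ (suc t)) agree (e (suc t) ≤-refl)
    entries′ : ∀ s u → setColumn t (pushCol t _ (g (suc t))) (table (forward t g)) s u
                     ≡ setColumn t (pushCol t _ (g′ (suc t))) (table (forward t g′)) s u
    entries′ s u with u ≟ t
    ... | no  _    = entries s u
    ... | yes refl with s <? u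
    ...   | yes s<u = proj₂ pushed s s<u
    ...   | no  s≮u = trans (pushCol-beyond u _ _ s (≮⇒≥ s≮u)) (sym (pushCol-beyond u _ _ s (≮⇒≥ s≮u)))

  walkAt-cong : ∀ a a′ → (∀ s t → s < t → t < k → a s t ≡ a′ s t) →
    ∀ t → t ≤ k → AgreeUpTo t (Rebuild.walkAt a t) (Rebuild.walkAt a′ t)
  walkAt-cong a a′ e = downward-induction k (λ t → AgreeUpTo t (A.walkAt t) (A′.walkAt t)) base
    (λ t t<k ih → subst₂ (AgreeUpTo t) (sym (A.walkAt-step t t<k)) (sym (A′.walkAt-step t t<k))
                          (next t t<k (agree-pred ih)))
    where
    module A  = Rebuild a
    module A′ = Rebuild a′
    base : AgreeUpTo k (A.walkAt k) (A′.walkAt k)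
    base rewrite n∸n≡0 k = λ _ _ _ → refl
    next : ∀ t → t < k → AgreeUpTo t (A.walkAt (suc t)) (A′.walkAt (suc t)) →
      AgreeUpTo t (A.nextWalk t (A.walkAt (suc t))) (A′.nextWalk t (A′.walkAt (suc t)))
    next t t<k ih with 0 <? colSum a t | 0 <? colSum a′ t
    ... | yes pos | no ¬pos = ⊥-elim (¬pos (subst (0 <_) same-sum pos))
      where same-sum = sumBelow-cong t (λ s s<t → e s t s<t t<k)
    ... | no ¬pos | yes pos = ⊥-elim (¬pos (subst (0 <_) (sym same-sum) pos))
      where same-sum = sumBelow-cong t (λ s s<t → e s t s<t t<k)
    ... | no  _ | no  _ = ih
    ... | yes _ | yes _ = pull-cong t _ _ _ _ ih (λ s s<t → e s t s<t t<k)

  forward-pushed-column : ∀ t g → sizeSh (g (suc t)) < sizeSh (g t) →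
    ∀ s → table (forward (suc t) g) s t ≡ pushCol t (walk (forward t g)) (g (suc t)) s
  forward-pushed-column t g dec s with sizeSh (g (suc t)) <? sizeSh (g t)
  ... | yes _    = update-same t _ _
  ... | no  ¬dec = ⊥-elim (¬dec dec)

  module FromWalk (g : Walk) (gw : OscWalk k g) (end : IsEmpty (g k)) where

    I = forward-inv k g gw ≤-refl
    a = table (forward k g)
    open Rebuild a

    final-empty : ∀ s → s ≤ k → IsEmpty (walk (forward k g) s)
    final-empty = UpWalk-empty k _ (ForwardInv.upWalk I)
                    (λ c → trans (cong-app (ForwardInv.top I) c) (end c))

    rowSum-rise : ∀ s → s < k → rowSum a s ≡ sizeSh (g (suc s)) ∸ sizeSh (g s)
    rowSum-rise s s<k = trans (cong (_+ rowSum a s) (sym no-rise)) (ForwardInv.row I s s<k)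
      where
      no-rise : rise (walk (forward k g)) s ≡ 0
      no-rise = cong₂ _∸_ (sumBelow-zero _ (suc k) (λ c _ → final-empty (suc s) s<k c))
                          (sumBelow-zero _ (suc k) (λ c _ → final-empty s (<⇒≤ s<k) c))

    colSum-fall : ∀ t → t < k → colSum a t ≡ sizeSh (g t) ∸ sizeSh (g (suc t))
    colSum-fall = ForwardInv.col I

    fpf : FPFTable a
    fpf = record { lowerZero = forward-LowerZero k g ; fixedPointFree = fixedPointFree }
      where
      fixedPointFree : ∀ t → t < k → colSum a t ≡ 0 ⊎ rowSum a t ≡ 0
      fixedPointFree t t<k with ≤-total (sizeSh (g t)) (sizeSh (g (suc t)))
      ... | inj₁ inc = inj₁ (trans (colSum-fall t t<k) (m≤n⇒m∸n≡0 inc))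
      ... | inj₂ dec = inj₂ (trans (rowSum-rise t t<k) (m≤n⇒m∸n≡0 dec))

    rebuild-undoes : ∀ t X → t < k → AgreeUpTo (suc t) X (walk (forward (suc t) g)) →
      AgreeUpTo t (nextWalk t X) (walk (forward t g))
    rebuild-undoes t X t<k X≈ with sizeSh (g (suc t)) <? sizeSh (g t) | 0 <? colSum a t
    ... | yes dec | no ¬pos = ⊥-elim (¬pos (subst (0 <_) (sym (colSum-fall t t<k)) (m<n⇒0<n∸m dec)))
    ... | no ¬dec | yes pos =
      ⊥-elim (<-irrefl (sym (m≤n⇒m∸n≡0 (≮⇒≥ ¬dec))) (subst (0 <_) (colSum-fall t t<k) pos))
    ... | no  _   | no  _   = agree-trans (agree-pred X≈) (update-below t _ _)
    ... | yes dec | yes _   = agree-trans pulls-agree (pull-push t τ ρ (ForwardInv.upWalk It) ρ⊂τ)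
      where
      It = forward-inv t g (OscWalk-≤ g gw (<⇒≤ t<k)) (<⇒≤ t<k)
      τ = walk (forward t g)
      ρ = g (suc t)
      ρ⊂τ : ρ ⊂ᵛ τ t
      ρ⊂τ with proj₂ gw t t<k
      ... | inj₁ up   = ⊥-elim (<⇒≱ dec (⊂ᵛ-size up))
      ... | inj₂ down = subst (ρ ⊂ᵛ_) (sym (ForwardInv.top It)) down
      pulls-agree : AgreeUpTo t (pull t X (column t)) (pull t (pushWalk t τ ρ) (pushCol t τ ρ))
      pulls-agree = pull-cong t X _ (column t) _
        (agree-trans (agree-pred X≈) (update-below t ρ _))
        (λ s _ → trans (forward-stable k g s t t<k) (forward-pushed-column t g dec s))

    walkAt-forward : ∀ t → t ≤ k → AgreeUpTo t (walkAt t) (walk (forward t g))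
    walkAt-forward = downward-induction k (λ t → AgreeUpTo t (walkAt t) (walk (forward t g))) base
      (λ t t<k ih → subst (λ w → AgreeUpTo t w (walk (forward t g))) (sym (walkAt-step t t<k))
                          (rebuild-undoes t _ t<k ih))
      where
      base : AgreeUpTo k (walkAt k) (walk (forward k g))
      base rewrite n∸n≡0 k = λ s s≤k c → sym (final-empty s s≤k c)

    recovered-walk : ∀ i → i ≤ k → recovered i ≗ g i
    recovered-walk i i≤k =
      ≗-trans (walkAt-forward i i≤k i ≤-refl)
              (cong-app (ForwardInv.top (forward-inv i g (OscWalk-≤ g gw i≤k) i≤k)))

indicator< : ℕ → ℕ → ℕ
indicator< c x with c <? x
... | yes _ = 1
... | no  _ = 0

indicator<-yes : ∀ {c x} → c < x → indicator< c x ≡ 1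
indicator<-yes {c} {x} c<x with c <? x
... | yes _   = refl
... | no  c≮x = ⊥-elim (c≮x c<x)

indicator<-no : ∀ {c x} → ¬ c < x → indicator< c x ≡ 0
indicator<-no {c} {x} c≮x with c <? x
... | yes c<x = ⊥-elim (c≮x c<x)
... | no  _   = refl

indicator<-≤1 : ∀ c x → indicator< c x ≤ 1
indicator<-≤1 c x with c <? x
... | yes _ = ≤-refl
... | no  _ = z≤n

conj : Partition → Shape
conj []      c = 0
conj (x ∷ μ) c = indicator< c x + conj μ c

≤-from-< : ∀ {x y} → (∀ r → r < x → r < y) → x ≤ y
≤-from-< {x} {y} h with x ≤? y
... | yes x≤y = x≤y
... | no  x≰y = ⊥-elim (<-irrefl refl (h y (≰⇒> x≰y)))

tail-≤-head : ∀ {x μ} → LL.Linked (λ a b → b ≤ a) (x ∷ μ) → ∀ r → part μ r ≤ x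
tail-≤-head {x} {[]}    _             r       = z≤n
tail-≤-head {x} {y ∷ μ} (y≤x LL.∷ _)  zero    = y≤x
tail-≤-head {x} {y ∷ μ} (y≤x LL.∷ l)  (suc r) = ≤-trans (tail-≤-head l r) y≤x

IsPartition-tail : ∀ {x μ} → IsPartition (x ∷ μ) → IsPartition μ
IsPartition-tail (_ LA.∷ pos , LL.[-])   = pos , LL.[]
IsPartition-tail (_ LA.∷ pos , _ LL.∷ l) = pos , l

part-≤-head : ∀ {μ} → IsPartition μ → ∀ r → part μ r ≤ part μ 0
part-≤-head {[]}    _       r       = z≤n
part-≤-head {x ∷ μ} _       zero    = ≤-refl
part-≤-head {x ∷ μ} (_ , l) (suc r) = tail-≤-head l r

conj-beyond : ∀ μ c → (∀ r → part μ r ≤ c) → conj μ c ≡ 0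
conj-beyond []      c _ = refl
conj-beyond (x ∷ μ) c h =
  cong₂ _+_ (indicator<-no (λ c<x → <-irrefl refl (<-≤-trans c<x (h 0))))
            (conj-beyond μ c (λ r → h (suc r)))

conj-intro : ∀ μ → IsPartition μ → ∀ r c → c < part μ r → r < conj μ c
conj-intro (x ∷ μ) p zero    c c<x rewrite indicator<-yes c<x = s≤s z≤n
conj-intro (x ∷ μ) p (suc r) c c<μr
  rewrite indicator<-yes (<-≤-trans c<μr (tail-≤-head (proj₂ p) r)) =
  s≤s (conj-intro μ (IsPartition-tail p) r c c<μr)

conj-elim : ∀ μ → IsPartition μ → ∀ r c → r < conj μ c → c < part μ r
conj-elim (x ∷ μ) p r c r<μ′c with c <? x
conj-elim (x ∷ μ) p zero    c _           | yes c<x = c<x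
conj-elim (x ∷ μ) p (suc r) c (s≤s r<μ′c) | yes _   = conj-elim μ (IsPartition-tail p) r c r<μ′c
... | no c≮x = ⊥-elim (<-irrefl (sym rest-empty) (<-≤-trans z<s r<μ′c))
  where
  rest-empty : conj μ c ≡ 0
  rest-empty = conj-beyond μ c (λ r → ≤-trans (tail-≤-head (proj₂ p) r) (≮⇒≥ c≮x))

conj-decreasing : ∀ μ → IsPartition μ → Decreasing (conj μ)
conj-decreasing μ p c =
  ≤-from-< (λ r r< → conj-intro μ p r c (<-trans (n<1+n c) (conj-elim μ p r (suc c) r<)))

vstrip⇒⊂ᵛ : ∀ μ ν → IsPartition μ → IsPartition ν → VerticalStrip μ ν → conj μ ⊂ᵛ conj ν
vstrip⇒⊂ᵛ μ ν pμ pν vs c =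
  ≤-from-< (λ r r< → conj-intro ν pν r c (<-≤-trans (conj-elim μ pμ r c r<) (proj₁ (vs r)))) ,
  ≤-from-< (λ r r< → conj-intro μ pμ r c
                       (s≤s⁻¹ (≤-trans (conj-elim ν pν r (suc c) r<) (proj₂ (vs r)))))

⊂ᵛ⇒vstrip : ∀ μ ν → IsPartition μ → IsPartition ν → conj μ ⊂ᵛ conj ν → VerticalStrip μ ν
⊂ᵛ⇒vstrip μ ν pμ pν h r =
  ≤-from-< (λ c c< → conj-elim ν pν r c (<-≤-trans (conj-intro μ pμ r c c<) (proj₁ (h c)))) ,
  ≤-from-< below
  where
  below : ∀ c → c < part ν r → c < suc (part μ r)
  below zero    _  = z<s
  below (suc c) c< = s≤s (conj-elim μ pμ r c (<-≤-trans (conj-intro ν pν r (suc c) c<) (proj₂ (h c))))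

size-conj : ∀ μ B → (∀ r → part μ r ≤ B) → size μ ≡ sumBelow (conj μ) B
size-conj []      B _ = sym (sumBelow-zero _ B (λ _ _ → refl))
size-conj (x ∷ μ) B h = begin
  x + sum μ
    ≡⟨ cong₂ _+_ (sym (trans (row x B) (m≥n⇒m⊓n≡n (h 0)))) (size-conj μ B (λ r → h (suc r))) ⟩
  sumBelow (λ c → indicator< c x) B + sumBelow (conj μ) B
    ≡⟨ sym (sumBelow-+ _ _ B) ⟩
  sumBelow (conj (x ∷ μ)) B ∎
  where
  open ≡-Reasoning
  row : ∀ x B → sumBelow (λ c → indicator< c x) B ≡ B ⊓ x
  row x zero    = refl
  row x (suc B) with B <? x
  ... | yes B<x rewrite row x B | m≤n⇒m⊓n≡m (<⇒≤ B<x) | m≤n⇒m⊓n≡m B<x = +-comm B 1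
  ... | no  B≮x rewrite row x B | m≥n⇒m⊓n≡n (≮⇒≥ B≮x) | m≥n⇒m⊓n≡n (m≤n⇒m≤1+n (≮⇒≥ B≮x)) =
    +-identityʳ x

head-bound : ∀ μ n → IsPartition μ → VanishFrom (conj μ) n → part μ 0 ≤ n
head-bound μ n p z = ≤-from-< below
  where
  below : ∀ c → c < part μ 0 → c < n
  below c c< with c <? n
  ... | yes c<n = c<n
  ... | no  c≮n = ⊥-elim (<-irrefl (sym (z c (≮⇒≥ c≮n))) (conj-intro μ p 0 c c<))

build : ℕ → (ℕ → ℕ) → Partition
build zero    h = []
build (suc n) h = h 0 ∷ build n (h ∘ suc)

part-build-< : ∀ n h r → r < n → part (build n h) r ≡ h r
part-build-< (suc n) h zero    _         = refl
part-build-< (suc n) h (suc r) (s≤s r<n) = part-build-< n (h ∘ suc) r r<n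

part-build-≥ : ∀ n h r → n ≤ r → part (build n h) r ≡ 0
part-build-≥ zero    h r       _         = refl
part-build-≥ (suc n) h (suc r) (s≤s n≤r) = part-build-≥ n (h ∘ suc) r n≤r

build-All : ∀ {P : ℕ → Set} n h → (∀ r → r < n → P (h r)) → LA.All P (build n h)
build-All zero    h _ = LA.[]
build-All (suc n) h f = f 0 z<s LA.∷ build-All n (h ∘ suc) (λ r r<n → f (suc r) (s≤s r<n))

build-decreasing : ∀ n h → Decreasing h → LL.Linked (λ a b → b ≤ a) (build n h)
build-decreasing zero          h _ = LL.[]
build-decreasing (suc zero)    h _ = LL.[-]
build-decreasing (suc (suc n)) h d = d 0 LL.∷ build-decreasing (suc n) (h ∘ suc) (d ∘ suc)

decreasing-≤ : ∀ {f} → Decreasing f → ∀ {c c′} → c ≤ c′ → f c′ ≤ f c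
decreasing-≤ d {c} {zero}   z≤n = ≤-refl
decreasing-≤ d {c} {suc c′} c≤1+c′ with m≤n⇒m<n∨m≡n c≤1+c′
... | inj₂ refl        = ≤-refl
... | inj₁ (s≤s c≤c′)  = ≤-trans (d c′) (decreasing-≤ d c≤c′)

-- The partition with conjugate f (columns below B): row r has as many boxes
-- as there are columns c < B of length > r.
rowLength : Shape → ℕ → ℕ → ℕ
rowLength f B r = sumBelow (λ c → indicator< r (f c)) B

fromShape : Shape → ℕ → Partition
fromShape f B = build (f 0) (rowLength f B)

rowLength-beyond : ∀ f B r → Decreasing f → f 0 ≤ r → rowLength f B r ≡ 0
rowLength-beyond f B r d f0≤r = n≤0⇒n≡0 (sumBelow-indicator _ 0 B (λ c → indicator<-≤1 r (f c))
  (λ c _ → indicator<-no (λ r<fc → <-irrefl refl (<-≤-trans r<fc (≤-trans (decreasing-≤ d z≤n) f0≤r)))))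

part-fromShape : ∀ f B → Decreasing f → ∀ r → part (fromShape f B) r ≡ rowLength f B r
part-fromShape f B d r with r <? f 0
... | yes r<f0 = part-build-< (f 0) _ r r<f0
... | no  r≮f0 = trans (part-build-≥ (f 0) _ r (≮⇒≥ r≮f0)) (sym (rowLength-beyond f B r d (≮⇒≥ r≮f0)))

rowLength-intro : ∀ f B → Decreasing f → VanishFrom f B → ∀ r c → r < f c → c < rowLength f B r
rowLength-intro f B d z r c r<fc =
  <-≤-trans (n<1+n c)
    (≤-trans (≤-reflexive (sym (sumBelow-ones _ (suc c)
                 (λ c′ c′<1+c → indicator<-yes (<-≤-trans r<fc (decreasing-≤ d (s≤s⁻¹ c′<1+c)))))))
             (sumBelow-monoʳ _ 1+c≤B))
  where
  1+c≤B : suc c ≤ B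
  1+c≤B with suc c ≤? B
  ... | yes 1+c≤B = 1+c≤B
  ... | no  1+c≰B = ⊥-elim (<-irrefl (sym (z c (s≤s⁻¹ (≰⇒> 1+c≰B)))) (<-≤-trans z<s r<fc))

rowLength-elim : ∀ f B → Decreasing f → ∀ r c → c < rowLength f B r → r < f c
rowLength-elim f B d r c c< with r <? f c
... | yes r<fc = r<fc
... | no  r≮fc = ⊥-elim (<-irrefl refl (<-≤-trans c<
      (sumBelow-indicator _ c B (λ c′ → indicator<-≤1 r (f c′))
         (λ c′ c≤c′ → indicator<-no (λ r<fc′ → r≮fc (<-≤-trans r<fc′ (decreasing-≤ d c≤c′)))))))

fromShape-IsPartition : ∀ f B → Decreasing f → VanishFrom f B → IsPartition (fromShape f B)
fromShape-IsPartition f B d z =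
  build-All (f 0) _ (λ r r<f0 → rowLength-intro f B d z r 0 r<f0) ,
  build-decreasing (f 0) _ (λ r → sumBelow-mono B (λ c → step r (f c)))
  where
  step : ∀ r x → indicator< (suc r) x ≤ indicator< r x
  step r x with suc r <? x
  ... | yes 1+r<x = ≤-reflexive (sym (indicator<-yes (<-trans (n<1+n r) 1+r<x)))
  ... | no  _     = z≤n

conj-fromShape : ∀ f B → Decreasing f → VanishFrom f B → conj (fromShape f B) ≗ f
conj-fromShape f B d z c = ≤-antisym
  (≤-from-< (λ r r< → rowLength-elim f B d r c
     (subst (c <_) (part-fromShape f B d r) (conj-elim _ p r c r<))))
  (≤-from-< (λ r r< → conj-intro _ p r c
     (subst (c <_) (sym (part-fromShape f B d r)) (rowLength-intro f B d z r c r<))))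
  where p = fromShape-IsPartition f B d z

part-injective : ∀ μ ν → LA.All (0 <_) μ → LA.All (0 <_) ν → (∀ r → part μ r ≡ part ν r) → μ ≡ ν
part-injective []      []      _             _             _ = refl
part-injective []      (y ∷ ν) _             (0<y LA.∷ _)  e = ⊥-elim (<-irrefl (e 0) 0<y)
part-injective (x ∷ μ) []      (0<x LA.∷ _)  _             e = ⊥-elim (<-irrefl (sym (e 0)) 0<x)
part-injective (x ∷ μ) (y ∷ ν) (_ LA.∷ pμ)   (_ LA.∷ pν)   e =
  cong₂ _∷_ (e 0) (part-injective μ ν pμ pν (λ r → e (suc r)))

fromShape-conj : ∀ f B μ → IsPartition μ → f ≗ conj μ → part μ 0 ≤ B → fromShape f B ≡ μ
fromShape-conj f B μ p e head≤B = part-injective _ μ (proj₁ p′) (proj₁ p) same-parts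
  where
  d : Decreasing f
  d c = subst₂ _≤_ (sym (e (suc c))) (sym (e c)) (conj-decreasing μ p c)
  z : VanishFrom f B
  z c B≤c = trans (e c) (conj-beyond μ c (λ r → ≤-trans (part-≤-head p r) (≤-trans head≤B B≤c)))
  p′ = fromShape-IsPartition f B d z
  same-parts : ∀ r → part (fromShape f B) r ≡ part μ r
  same-parts r = ≤-antisym
    (≤-from-< (λ c c< → conj-elim μ p r c (subst (r <_) (e c)
                 (rowLength-elim f B d r c (subst (c <_) (part-fromShape f B d r) c<)))))
    (≤-from-< (λ c c< → subst (c <_) (sym (part-fromShape f B d r))
                 (rowLength-intro f B d z r c (subst (r <_) (sym (e c)) (conj-intro μ p r c c<)))))

fromShape-empty : ∀ f B → f 0 ≡ 0 → fromShape f B ≡ []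
fromShape-empty f B e rewrite e = refl

-- Matrices.  A table with zero lower triangle determines a symmetric matrix
-- with zero diagonal; its row content r_i is row sum i of the table and its
-- column content c_i is column sum i.

symm : Table → ℕ → ℕ → ℕ
symm a i j with <-cmp i j
... | tri< _ _ _ = a i j
... | tri≈ _ _ _ = 0
... | tri> _ _ _ = a j i

symm-< : ∀ a {i j} → i < j → symm a i j ≡ a i j
symm-< a {i} {j} i<j with <-cmp i j
... | tri< _ _   _   = refl
... | tri≈ _ i≡j _   = ⊥-elim (<-irrefl i≡j i<j)
... | tri> _ _   j<i = ⊥-elim (<-asym i<j j<i)

symm-> : ∀ a {i j} → j < i → symm a i j ≡ a j i
symm-> a {i} {j} j<i with <-cmp i j
... | tri< i<j _   _ = ⊥-elim (<-asym j<i i<j)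
... | tri≈ _   i≡j _ = ⊥-elim (<-irrefl (sym i≡j) j<i)
... | tri> _   _   _ = refl

symm-diagonal : ∀ a i → symm a i i ≡ 0
symm-diagonal a i with <-cmp i i
... | tri< i<i _ _   = ⊥-elim (<-irrefl refl i<i)
... | tri≈ _   _ _   = refl
... | tri> _   _ i<i = ⊥-elim (<-irrefl refl i<i)

symm-sym : ∀ a i j → symm a i j ≡ symm a j i
symm-sym a i j with <-cmp i j
... | tri< i<j _ _   = sym (symm-> a i<j)
... | tri≈ _ refl _  = sym (symm-diagonal a i)
... | tri> _ _   j<i = sym (symm-< a j<i)

-- Trichotomy as a sum, for case splits that keep the goal unreduced.
trichotomy : ∀ i j → i < j ⊎ i ≡ j ⊎ j < i
trichotomy i j with <-cmp i j
... | tri< i<j _ _ = inj₁ i<j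
... | tri≈ _ i≡j _ = inj₂ (inj₁ i≡j)
... | tri> _ _ j<i = inj₂ (inj₂ j<i)

toMatrix : ∀ k → Table → Matrix k
toMatrix k a = V.tabulate (λ i → V.tabulate (λ j → symm a (toℕ i) (toℕ j)))

Represents : ∀ {k} → Matrix k → Table → Set
Represents M a = ∀ i j → entry M i j ≡ symm a (toℕ i) (toℕ j)

toMatrix-represents : ∀ k a → Represents (toMatrix k a) a
toMatrix-represents k a i j =
  trans (cong (λ row → V.lookup row j) (VP.lookup∘tabulate _ i)) (VP.lookup∘tabulate _ j)

toMatrix-symmetric : ∀ k a → IsSymmetric (toMatrix k a)
toMatrix-symmetric k a i j =
  trans (toMatrix-represents k a i j)
        (trans (symm-sym a (toℕ i) (toℕ j)) (sym (toMatrix-represents k a j i)))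

represents-unique : ∀ {k} (M : Matrix k) a → Represents M a → M ≡ toMatrix k a
represents-unique M a m = trans (sym (VP.tabulate∘lookup M))
  (VP.tabulate-cong (λ i → trans (sym (VP.tabulate∘lookup (V.lookup M i))) (VP.tabulate-cong (m i))))

toMatrix-cong : ∀ k (b b′ : Table) → (∀ s u → u < k → b s u ≡ b′ s u) → toMatrix k b ≡ toMatrix k b′
toMatrix-cong k b b′ e = VP.tabulate-cong (λ i → VP.tabulate-cong (λ j →
  same (toℕ i) (toℕ j) (FP.toℕ<n i) (FP.toℕ<n j)))
  where
  same : ∀ i j → i < k → j < k → symm b i j ≡ symm b′ i j
  same i j i<k j<k with <-cmp i j
  ... | tri< _ _ _ = e i j j<k
  ... | tri≈ _ _ _ = refl
  ... | tri> _ _ _ = e j i i<k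

masked : ∀ {A : Set} {P : A → Set} → Decidable P → (A → ℕ) → A → ℕ
masked P? f x with does (P? x)
... | true  = f x
... | false = 0

sum-filter : ∀ {A : Set} {P : A → Set} (P? : Decidable P) (f : A → ℕ) xs →
  sum (map f (filter P? xs)) ≡ sum (map (masked P? f) xs)
sum-filter P? f []       = refl
sum-filter P? f (x ∷ xs) with does (P? x)
... | true  = cong (f x +_) (sum-filter P? f xs)
... | false = sum-filter P? f xs

masked-yes : ∀ {A : Set} {P : A → Set} (P? : Decidable P) f x → P x → masked P? f x ≡ f x
masked-yes P? f x px with P? x
... | yes _  = refl
... | no ¬px = ⊥-elim (¬px px)

masked-no : ∀ {A : Set} {P : A → Set} (P? : Decidable P) f x → ¬ P x → masked P? f x ≡ 0
masked-no P? f x ¬px with P? x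
... | yes px = ⊥-elim (¬px px)
... | no  _  = refl

sum-allFin : ∀ n (h : Fin n → ℕ) (H : ℕ → ℕ) → (∀ j → h j ≡ H (toℕ j)) →
  sum (map h (allFin n)) ≡ sumBelow H n
sum-allFin n h H e = trans (cong sum (LP.map-tabulate id h)) (sum-tabulate n h H e)
  where
  sum-tabulate : ∀ n (h : Fin n → ℕ) (H : ℕ → ℕ) → (∀ j → h j ≡ H (toℕ j)) →
    sum (tabulate h) ≡ sumBelow H n
  sum-tabulate zero    h H e = refl
  sum-tabulate (suc n) h H e =
    trans (cong₂ _+_ (e F.zero) (sum-tabulate n (h ∘ F.suc) (H ∘ suc) (λ j → e (F.suc j))))
          (sym (sumBelow-shift H n))

rowContent-table : ∀ {k} (M : Matrix k) a → Represents M a → LowerZero a →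
  ∀ i → rowContent M i ≡ sumBelow (a (toℕ i)) k
rowContent-table {k} M a m low i =
  trans (sum-filter (i FP.≤?_) (entry M i) (allFin k)) (sum-allFin k _ _ term)
  where
  term : ∀ j → masked (i FP.≤?_) (entry M i) j ≡ a (toℕ i) (toℕ j)
  term j with toSum (i FP.≤? j)
  ... | inj₂ i≰j = trans (masked-no (i FP.≤?_) (entry M i) j i≰j) (sym (low _ _ (<⇒≤ (≰⇒> i≰j))))
  ... | inj₁ i≤j rewrite masked-yes (i FP.≤?_) (entry M i) j i≤j with <-cmp (toℕ i) (toℕ j)
  ...   | tri< i<j _ _ = trans (m i j) (symm-< a i<j)
  ...   | tri≈ _ i≡j _ = trans (m i j) (trans (cong (symm a (toℕ i)) (sym i≡j))
                           (trans (symm-diagonal a (toℕ i)) (sym (low _ _ (≤-reflexive (sym i≡j))))))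
  ...   | tri> _ _ j<i = ⊥-elim (<-irrefl refl (<-≤-trans j<i i≤j))

colContent-table : ∀ {k} (M : Matrix k) a → Represents M a → LowerZero a →
  ∀ i → colContent M i ≡ sumBelow (λ s → a s (toℕ i)) k
colContent-table {k} M a m low i =
  trans (sum-filter (FP._≤? i) (λ j → entry M j i) (allFin k)) (sum-allFin k _ _ term)
  where
  term : ∀ j → masked (FP._≤? i) (λ j → entry M j i) j ≡ a (toℕ j) (toℕ i)
  term j with toSum (j FP.≤? i)
  ... | inj₂ j≰i = trans (masked-no (FP._≤? i) (λ j → entry M j i) j j≰i) (sym (low _ _ (<⇒≤ (≰⇒> j≰i))))
  ... | inj₁ j≤i rewrite masked-yes (FP._≤? i) (λ j → entry M j i) j j≤i with <-cmp (toℕ j) (toℕ i)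
  ...   | tri< j<i _ _ = trans (m j i) (symm-< a j<i)
  ...   | tri≈ _ j≡i _ = trans (m j i) (trans (cong (symm a (toℕ j)) (sym j≡i))
                           (trans (symm-diagonal a (toℕ j)) (sym (low _ _ (≤-reflexive (sym j≡i))))))
  ...   | tri> _ _ i<j = ⊥-elim (<-irrefl refl (<-≤-trans i<j j≤i))

fromMatrix : ∀ {k} → Matrix k → Table
fromMatrix {k} A s u with s <? k | u <? k | s <? u
... | yes s<k | yes u<k | yes _ = entry A (F.fromℕ< s<k) (F.fromℕ< u<k)
... | _       | _       | _     = 0

fromMatrix-entry : ∀ {k} (A : Matrix k) s u (s<u : s < u) (u<k : u < k) →
  fromMatrix A s u ≡ entry A (F.fromℕ< (<-trans s<u u<k)) (F.fromℕ< u<k)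
fromMatrix-entry {k} A s u s<u u<k with s <? k | u <? k | s <? u
... | yes _   | yes _   | yes _ = refl
... | no  s≮k | _       | _     = ⊥-elim (s≮k (<-trans s<u u<k))
... | yes _   | no  u≮k | _     = ⊥-elim (u≮k u<k)
... | yes _   | yes _   | no  s≮u = ⊥-elim (s≮u s<u)

fromMatrix-LowerZero : ∀ {k} (A : Matrix k) → LowerZero (fromMatrix A)
fromMatrix-LowerZero {k} A s u u≤s with s <? k | u <? k | s <? u
... | yes _ | yes _ | yes s<u = ⊥-elim (<-irrefl refl (<-≤-trans s<u u≤s))
... | yes _ | yes _ | no  _   = refl
... | yes _ | no  _ | _       = refl
... | no  _ | _     | _       = refl

sum-≥ : ∀ {A : Set} (f : A → ℕ) {x xs} → x ∈ xs → f x ≤ sum (map f xs)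
sum-≥ f (here refl)          = m≤m+n _ _
sum-≥ f {xs = y ∷ _} (there x∈) = ≤-trans (sum-≥ f x∈) (m≤n+m _ (f y))

-- The diagonal of a fixed-point-free involution vanishes, as a_ii occurs in
-- both r_i and c_i.
diagonal-zero : ∀ {k} (A : Matrix k) → (∀ i → rowContent A i ≡ 0 ⊎ colContent A i ≡ 0) →
  ∀ i → entry A i i ≡ 0
diagonal-zero {k} A h i with h i
... | inj₁ r0 = n≤0⇒n≡0 (subst (entry A i i ≤_) r0
    (sum-≥ (entry A i) (∈-filter⁺ (i FP.≤?_) (∈-allFin i) (FP.≤-refl {x = i}))))
... | inj₂ c0 = n≤0⇒n≡0 (subst (entry A i i ≤_) c0
    (sum-≥ (λ j → entry A j i) (∈-filter⁺ (FP._≤? i) (∈-allFin i) (FP.≤-refl {x = i}))))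

fromMatrix-upper : ∀ {k} (A : Matrix k) i j → toℕ i < toℕ j → fromMatrix A (toℕ i) (toℕ j) ≡ entry A i j
fromMatrix-upper A i j i<j = trans (fromMatrix-entry A _ _ i<j (FP.toℕ<n j))
  (cong₂ (entry A) (FP.fromℕ<-toℕ i _) (FP.fromℕ<-toℕ j _))

fromMatrix-represents : ∀ {k} (A : Matrix k) → IsNNFPFI A → Represents A (fromMatrix A)
fromMatrix-represents A (symmetric , fpf) i j with trichotomy (toℕ i) (toℕ j)
... | inj₁ i<j = trans (sym (fromMatrix-upper A i j i<j)) (sym (symm-< (fromMatrix A) i<j))
... | inj₂ (inj₁ i≡j) rewrite FP.toℕ-injective i≡j =
  trans (diagonal-zero A fpf j) (sym (symm-diagonal (fromMatrix A) (toℕ j)))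
... | inj₂ (inj₂ j<i) =
  trans (symmetric i j) (trans (sym (fromMatrix-upper A j i j<i)) (sym (symm-> (fromMatrix A) j<i)))

head-lookup : ∀ {A : Set} {n} (v : V.Vec A (suc n)) → V.head v ≡ V.lookup v F.zero
head-lookup (x V.∷ _) = refl

last-lookup : ∀ {A : Set} {n} (v : V.Vec A (suc n)) → V.last v ≡ V.lookup v (F.fromℕ n)
last-lookup {n = zero}  (x V.∷ V.[]) = refl
last-lookup {n = suc n} (x V.∷ xs)   = last-lookup xs

OscWalk-vanish : ∀ t g → OscWalk t g → ∀ s → s ≤ t → VanishFrom (g s) s
OscWalk-vanish t g (z , _)    zero    _   c _ = z c
OscWalk-vanish t g gw@(_ , h) (suc s) s<t with h s s<t
... | inj₁ up   = ⊂ᵛ-vanish-suc up (OscWalk-vanish t g gw s (<⇒≤ s<t))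
... | inj₂ down = ⊂ᵛ-vanish down (VanishFrom-mono (OscWalk-vanish t g gw s (<⇒≤ s<t)) (n≤1+n s))

module Correspondence (k : ℕ) where

  open Backward k

  -- The i-th partition of a tableau, indexed by ℕ (empty beyond k).
  shapeAt : V.Vec Partition (suc k) → ℕ → Partition
  shapeAt v i with i <? suc k
  ... | yes i<1+k = lookup v (F.fromℕ< i<1+k)
  ... | no  _     = []

  shapeAt-lookup : ∀ v j → shapeAt v (toℕ j) ≡ lookup v j
  shapeAt-lookup v j with toℕ j <? suc k
  ... | yes j<1+k = cong (lookup v) (FP.fromℕ<-toℕ j j<1+k)
  ... | no  j≮1+k = ⊥-elim (j≮1+k (FP.toℕ<n j))

  shapeAt-IsPartition : ∀ v → VAll.All IsPartition v → ∀ s → IsPartition (shapeAt v s)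
  shapeAt-IsPartition v all s with s <? suc k
  ... | yes s<1+k = VAllP.lookup⁺ all (F.fromℕ< s<1+k)
  ... | no  _     = LA.[] , LL.[]

  walkOf : V.Vec Partition (suc k) → Walk
  walkOf v i = conj (shapeAt v i)

  module OfTableau (T : OscTableau k) where

    v = proj₁ T
    all = proj₁ (proj₂ T)
    g = walkOf v

    shapeAt-inject₁ : ∀ (i : Fin k) → shapeAt v (toℕ i) ≡ lookup v (inject₁ i)
    shapeAt-inject₁ i = trans (cong (shapeAt v) (sym (FP.toℕ-inject₁ i))) (shapeAt-lookup v (inject₁ i))

    oscWalk : OscWalk k g
    oscWalk = start , steps
      where
      start : IsEmpty (g 0)
      start c = cong (λ μ → conj μ c)
        (trans (shapeAt-lookup v F.zero) (trans (sym (head-lookup v)) (proj₁ (proj₂ (proj₂ T)))))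
      steps : ∀ s → s < k → g s ⊂ᵛ g (suc s) ⊎ g (suc s) ⊂ᵛ g s
      steps s s<k = orient (proj₂ (proj₂ (proj₂ (proj₂ T))) i)
        where
        i = F.fromℕ< s<k
        this : shapeAt v s ≡ lookup v (inject₁ i)
        this = subst (λ x → shapeAt v x ≡ lookup v (inject₁ i)) (FP.toℕ-fromℕ< s<k) (shapeAt-inject₁ i)
        next : shapeAt v (suc s) ≡ lookup v (F.suc i)
        next = subst (λ x → shapeAt v (suc x) ≡ lookup v (F.suc i)) (FP.toℕ-fromℕ< s<k)
                     (shapeAt-lookup v (F.suc i))
        pμ = VAllP.lookup⁺ all (inject₁ i)
        pν = VAllP.lookup⁺ all (F.suc i)
        orient : DifferByVStrip (lookup v (inject₁ i)) (lookup v (F.suc i)) →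
          g s ⊂ᵛ g (suc s) ⊎ g (suc s) ⊂ᵛ g s
        orient (inj₁ vs) = inj₁ (subst₂ (λ μ ν → conj μ ⊂ᵛ conj ν) (sym this) (sym next) (vstrip⇒⊂ᵛ _ _ pμ pν vs))
        orient (inj₂ vs) = inj₂ (subst₂ (λ μ ν → conj μ ⊂ᵛ conj ν) (sym next) (sym this) (vstrip⇒⊂ᵛ _ _ pν pμ vs))

    end : IsEmpty (g k)
    end c = cong (λ μ → conj μ c)
      (trans (trans (cong (shapeAt v) (sym (FP.toℕ-fromℕ k))) (shapeAt-lookup v (F.fromℕ k)))
             (trans (sym (last-lookup v)) (proj₁ (proj₂ (proj₂ (proj₂ T))))))

    open FromWalk g oscWalk end public

    matrix : Matrix k
    matrix = toMatrix k a

    colContent-colSum : ∀ i → colContent matrix i ≡ colSum a (toℕ i)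
    colContent-colSum i =
      trans (colContent-table matrix a (toMatrix-represents k a) (forward-LowerZero k g) i)
            (sumBelow-stable _ k (λ s → forward-LowerZero k g s (toℕ i)) (<⇒≤ (FP.toℕ<n i)))

    rowContent-rowSum : ∀ i → rowContent matrix i ≡ rowSum a (toℕ i)
    rowContent-rowSum = rowContent-table matrix a (toMatrix-represents k a) (forward-LowerZero k g)

    isNNFPFI : IsNNFPFI matrix
    isNNFPFI = toMatrix-symmetric k a , λ i → fpf′ i (FPFTable.fixedPointFree fpf (toℕ i) (FP.toℕ<n i))
      where
      fpf′ : ∀ i → colSum a (toℕ i) ≡ 0 ⊎ rowSum a (toℕ i) ≡ 0 → rowContent matrix i ≡ 0 ⊎ colContent matrix i ≡ 0
      fpf′ i (inj₁ c0) = inj₂ (trans (colContent-colSum i) c0)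
      fpf′ i (inj₂ r0) = inj₁ (trans (rowContent-rowSum i) r0)

    size-walk : ∀ s → s ≤ k → sizeSh (g s) ≡ size (shapeAt v s)
    size-walk s s≤k = sym (size-conj (shapeAt v s) (suc k) (λ r → ≤-trans (part-≤-head p r)
      (≤-trans (head-bound _ s p (OscWalk-vanish k g oscWalk s s≤k)) (m≤n⇒m≤1+n s≤k))))
      where p = shapeAt-IsPartition v all s

    size-this : ∀ (i : Fin k) → sizeSh (g (toℕ i)) ≡ size (lookup v (inject₁ i))
    size-this i = trans (size-walk (toℕ i) (<⇒≤ (FP.toℕ<n i))) (cong size (shapeAt-inject₁ i))

    size-next : ∀ (i : Fin k) → sizeSh (g (suc (toℕ i))) ≡ size (lookup v (F.suc i))
    size-next i = trans (size-walk (suc (toℕ i)) (FP.toℕ<n i)) (cong size (shapeAt-lookup v (F.suc i)))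

    rowContent-Φ : ∀ i → rowContent matrix i ≡ size (lookup v (F.suc i)) ∸ size (lookup v (inject₁ i))
    rowContent-Φ i = trans (rowContent-rowSum i)
      (trans (rowSum-rise (toℕ i) (FP.toℕ<n i)) (cong₂ _∸_ (size-next i) (size-this i)))

    colContent-Φ : ∀ i → colContent matrix i ≡ size (lookup v (inject₁ i)) ∸ size (lookup v (F.suc i))
    colContent-Φ i = trans (colContent-colSum i)
      (trans (colSum-fall (toℕ i) (FP.toℕ<n i)) (cong₂ _∸_ (size-this i) (size-next i)))

  Φ : OscTableau k → NNFPFI k
  Φ T = OfTableau.matrix T , OfTableau.isNNFPFI T

  tableauOf : Matrix k → V.Vec Partition (suc k)
  tableauOf M = V.tabulate (λ j → fromShape (Rebuild.recovered (fromMatrix M) (toℕ j)) (suc k))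

  module OfMatrix (A : NNFPFI k) where

    M = proj₁ A
    a = fromMatrix M
    open Rebuild a public

    represents : Represents M a
    represents = fromMatrix-represents M (proj₂ A)

    fpf : FPFTable a
    fpf = record { lowerZero = fromMatrix-LowerZero M ; fixedPointFree = fixedPointFree }
      where
      fixedPointFree : ∀ t → t < k → colSum a t ≡ 0 ⊎ rowSum a t ≡ 0
      fixedPointFree t t<k with proj₂ (proj₂ A) (F.fromℕ< t<k)
      ... | inj₁ r0 = inj₂ (subst (λ x → rowSum a x ≡ 0) (FP.toℕ-fromℕ< t<k)
              (trans (sym (rowContent-table M a represents (fromMatrix-LowerZero M) _)) r0))
      ... | inj₂ c0 = inj₁ (subst (λ x → colSum a x ≡ 0) (FP.toℕ-fromℕ< t<k)
              (trans (sym (sumBelow-stable _ k (λ s → fromMatrix-LowerZero M s _)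
                                           (<⇒≤ (FP.toℕ<n (F.fromℕ< t<k)))))
                     (trans (sym (colContent-table M a represents (fromMatrix-LowerZero M) _)) c0)))

    upWalk : ∀ j → j ≤ k → UpWalk j (walkAt j)
    upWalk j j≤k = BackwardInv.upWalk (walkAt-inv fpf j j≤k)

    recovered-decreasing : ∀ j → j ≤ k → Decreasing (recovered j)
    recovered-decreasing j j≤k = UpWalk-decreasing j _ (upWalk j j≤k) j ≤-refl

    recovered-vanish : ∀ j → j ≤ k → VanishFrom (recovered j) (suc k)
    recovered-vanish j j≤k = VanishFrom-mono (UpWalk-vanish j _ (upWalk j j≤k) j ≤-refl) (m≤n⇒m≤1+n j≤k)

    partitionAt : ℕ → Partition
    partitionAt j = fromShape (recovered j) (suc k)

    partitionAt-IsPartition : ∀ j → j ≤ k → IsPartition (partitionAt j)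
    partitionAt-IsPartition j j≤k =
      fromShape-IsPartition _ (suc k) (recovered-decreasing j j≤k) (recovered-vanish j j≤k)

    conj-partitionAt : ∀ j → j ≤ k → conj (partitionAt j) ≗ recovered j
    conj-partitionAt j j≤k = conj-fromShape _ (suc k) (recovered-decreasing j j≤k) (recovered-vanish j j≤k)

    shapes = tableauOf M

    lookup-shapes : ∀ j → lookup shapes j ≡ partitionAt (toℕ j)
    lookup-shapes = VP.lookup∘tabulate (λ j → partitionAt (toℕ j))

    isTableau : IsOscTableau k shapes
    isTableau =
      VAllP.tabulate⁺ (λ j → partitionAt-IsPartition (toℕ j) (s≤s⁻¹ (FP.toℕ<n j))) ,
      fromShape-empty _ (suc k) (proj₁ (upWalk 0 z≤n) 0) ,
      trans (last-lookup shapes) (trans (lookup-shapes (F.fromℕ k)) (fromShape-empty _ (suc k) last-empty)) ,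
      strip
      where
      last-empty : recovered (toℕ (F.fromℕ k)) 0 ≡ 0
      last-empty rewrite FP.toℕ-fromℕ k = cong (λ d → rebuild d k 0) (n∸n≡0 k)
      strip : ∀ (i : Fin k) → DifferByVStrip (lookup shapes (inject₁ i)) (lookup shapes (F.suc i))
      strip i rewrite lookup-shapes (inject₁ i) | lookup-shapes (F.suc i) | FP.toℕ-inject₁ i =
        classify (step-kind fpf (toℕ i) (FP.toℕ<n i))
        where
        t = toℕ i
        t≤k = <⇒≤ (FP.toℕ<n i)
        1+t≤k = FP.toℕ<n i
        toPartitions : ∀ {s s′} (s≤k : s ≤ k) (s′≤k : s′ ≤ k) → recovered s ⊂ᵛ recovered s′ →
          VerticalStrip (partitionAt s) (partitionAt s′)
        toPartitions s≤k s′≤k h = ⊂ᵛ⇒vstrip _ _ (partitionAt-IsPartition _ s≤k) (partitionAt-IsPartition _ s′≤k)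
          (⊂ᵛ-cong (≗-sym (conj-partitionAt _ s≤k)) (≗-sym (conj-partitionAt _ s′≤k)) h)
        classify : StepKind fpf t → DifferByVStrip (partitionAt t) (partitionAt (suc t))
        classify (pulled _ down _ _ _) = inj₂ (toPartitions 1+t≤k t≤k down)
        classify (kept _ up _)         = inj₁ (toPartitions t≤k 1+t≤k up)

  Ψ : NNFPFI k → OscTableau k
  Ψ A = tableauOf (proj₁ A) , OfMatrix.isTableau A

  Φ-Ψ : ∀ A → proj₁ (Φ (Ψ A)) ≡ proj₁ A
  Φ-Ψ A = sym (trans (represents-unique M a represents) (toMatrix-cong k _ _ same-table))
    where
    open OfMatrix A
    g = walkOf shapes
    g≈recovered : ∀ i → i ≤ k → g i ≗ recovered i
    g≈recovered i i≤k c = begin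
      conj (shapeAt shapes i) c
        ≡⟨ cong (λ x → conj (shapeAt shapes x) c) (sym (FP.toℕ-fromℕ< (s≤s i≤k))) ⟩
      conj (shapeAt shapes (toℕ j)) c
        ≡⟨ cong (λ μ → conj μ c) (trans (shapeAt-lookup shapes j) (lookup-shapes j)) ⟩
      conj (partitionAt (toℕ j)) c
        ≡⟨ cong (λ x → conj (partitionAt x) c) (FP.toℕ-fromℕ< (s≤s i≤k)) ⟩
      conj (partitionAt i) c
        ≡⟨ conj-partitionAt i i≤k c ⟩
      recovered i c ∎
      where
      open ≡-Reasoning
      j = F.fromℕ< (s≤s i≤k)
    same-table : ∀ s u → u < k → a s u ≡ table (forward k g) s u
    same-table s u u<k = sym (trans (proj₂ (forward-cong k g recovered g≈recovered) s u)
                                    (proj₂ (forward-recovered fpf k ≤-refl) s u u<k))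

  Ψ-Φ : ∀ T → tableauOf (proj₁ (Φ T)) ≡ proj₁ T
  Ψ-Φ T = trans (VP.tabulate-cong same-partition) (VP.tabulate∘lookup v)
    where
    open OfTableau T
    upper : ∀ s t → s < t → t < k → fromMatrix matrix s t ≡ a s t
    upper s t s<t t<k = trans (fromMatrix-entry matrix s t s<t t<k)
      (trans (toMatrix-represents k a _ _)
        (trans (cong₂ (symm a) (FP.toℕ-fromℕ< (<-trans s<t t<k)) (FP.toℕ-fromℕ< t<k)) (symm-< a s<t)))
    same-partition : ∀ j → fromShape (Rebuild.recovered (fromMatrix matrix) (toℕ j)) (suc k) ≡ lookup v j
    same-partition j = trans (fromShape-conj _ (suc k) (shapeAt v t) p same-shape head≤)
                             (shapeAt-lookup v j)
      where
      t = toℕ j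
      t≤k = s≤s⁻¹ (FP.toℕ<n j)
      p = shapeAt-IsPartition v all t
      same-shape : Rebuild.recovered (fromMatrix matrix) t ≗ conj (shapeAt v t)
      same-shape = ≗-trans (walkAt-cong (fromMatrix matrix) a upper t t≤k t ≤-refl) (recovered-walk t t≤k)
      head≤ : part (shapeAt v t) 0 ≤ suc k
      head≤ = ≤-trans (head-bound _ t p (OscWalk-vanish k g oscWalk t t≤k)) (m≤n⇒m≤1+n t≤k)

-- The construction works for every k.
theorem6p10 : (k : ℕ) → 1 ≤ k →
    Σ (OscTableau k → NNFPFI k) λ Φ →
      (∀ T T′ → proj₁ (Φ T) ≡ proj₁ (Φ T′) → proj₁ T ≡ proj₁ T′) ×
      (∀ (A : NNFPFI k) → ∃ λ T → proj₁ (Φ T) ≡ proj₁ A) ×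
      (∀ (T : OscTableau k) (i : Fin k) →
        (rowContent (proj₁ (Φ T)) i
           ≡ size (lookup (proj₁ T) (Data.Fin.suc i)) ∸ size (lookup (proj₁ T) (inject₁ i)))
        ×
        (colContent (proj₁ (Φ T)) i
           ≡ size (lookup (proj₁ T) (inject₁ i)) ∸ size (lookup (proj₁ T) (Data.Fin.suc i))))
theorem6p10 k _ =
  Φ , injective , (λ A → Ψ A , Φ-Ψ A) ,
  (λ T i → OfTableau.rowContent-Φ T i , OfTableau.colContent-Φ T i)
  where
  open Correspondence k
  injective : ∀ T T′ → proj₁ (Φ T) ≡ proj₁ (Φ T′) → proj₁ T ≡ proj₁ T′
  injective T T′ eq = trans (sym (Ψ-Φ T)) (trans (cong tableauOf eq) (Ψ-Φ T′))
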